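{- Let $n>k\geq 2$. Let $T_n$ be the rooted tree on $n^2+1$ nodes whose root $r$ has children $v_1,\dots,v_n$, and which has leaves $s_{i,j},t_{i,j}$ for $1\leq i<j\leq n$, where $s_{i,j}$ is a child of $v_i$ and $t_{i,j}$ is a child of $v_j$. Let $e_i=rv_i$, $e_{i,j}=v_is_{i,j}$, $f_{i,j}=v_jt_{i,j}$, $L_1^n=\{e_1,\dots,e_n\}$, $L_2^n=\{e_{i,j},f_{i,j}:1\leq i<j\leq n\}$, and $S_n=\{\{s_{i,j},t_{i,j}\}:1\leq i<j\leq n\}$. Then the inequality $$(n-k)\sum_{e\in L_1^n}x_e+\sum_{e\in L_2^n}x_e\geq k(n-k)+\binom{n-k}{2}$$ defines a shared facet of $\mathrm{MultC}(T_n,S_n)$.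
   Context: Given a graph $G=(V,E)$ and $S\subseteq\binom{V}{2}$, an ($S$-)multicut is a set $\delta\subseteq E$ such that for every $\{s,t\}\in S$ the nodes $s$ and $t$ lie in different components of $G-\delta$. For $F\subseteq E$, $x^F\in\mathbb{R}^E$ is its incidence vector. The multicut polytope is $\mathrm{MultC}^{\square}(G,S)=\mathrm{conv}\{x^\delta:\delta\text{ an } S\text{ -multicut}\}$ and the multicut dominant is $\mathrm{MultC}(G,S)=\mathrm{MultC}^{\square}(G,S)+\mathbb{R}^E_{\geq 0}$. A facet-defining inequality of $\mathrm{MultC}(G,S)$ defines a shared facet if it is also facet-defining for $\mathrm{MultC}^{\square}(G,S)$. -}

module Defs where

open import Data.Nat as ℕ using (ℕ; zero; suc; _∸_)
open import Data.Nat.Combinatorics using (_C_)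
open import Data.Integer using (+_)
open import Data.Rational using (ℚ; 0ℚ; 1ℚ; _+_; _*_; _≤_; _/_)
open import Data.Fin using (Fin; zero; suc; _<_)
open import Data.Fin.Properties using (_<?_)
open import Data.Bool using (Bool; true; false; if_then_else_)
open import Data.Product using (_×_; _,_; ∃; Σ; proj₁; proj₂)
open import Data.Sum using (_⊎_)
open import Data.Empty using (⊥)
open import Relation.Nullary using (¬_; yes; no)
open import Relation.Binary.PropositionalEquality using (_≡_)

ΣFin : (k : ℕ) → (Fin k → ℚ) → ℚ
ΣFin zero    f = 0ℚ
ΣFin (suc k) f = f zero + ΣFin k (λ i → f (suc i))

InConv : {E : Set} → ((E → ℚ) → Set) → (E → ℚ) → Set
InConv {E} P x =
  ∃ λ (k : ℕ) → Σ (Fin k → E → ℚ) λ p → Σ (Fin k → ℚ) λ λ' →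
    ((i : Fin k) → P (p i)) ×
    ((i : Fin k) → 0ℚ ≤ λ' i) ×
    (ΣFin k λ' ≡ 1ℚ) ×
    ((e : E) → x e ≡ ΣFin k (λ i → λ' i * p i e))

Dominant : {E : Set} → ((E → ℚ) → Set) → (E → ℚ) → Set
Dominant {E} P x = ∃ λ y → P y × ((e : E) → y e ≤ x e)

AffIndep : {E : Set} {m : ℕ} → (Fin m → E → ℚ) → Set
AffIndep {E} {m} p = (μ : Fin m → ℚ) → ΣFin m μ ≡ 0ℚ →
  ((e : E) → ΣFin m (λ i → μ i * p i e) ≡ 0ℚ) → (i : Fin m) → μ i ≡ 0ℚ

-- the maximum number of affinely independent points in P is exactly m
-- (i.e. dim P = m - 1)
AffRank : {E : Set} → ((E → ℚ) → Set) → ℕ → Set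
AffRank {E} P m =
  (Σ (Fin m → E → ℚ) λ p → ((i : Fin m) → P (p i)) × AffIndep p) ×
  ¬ (Σ (Fin (suc m) → E → ℚ) λ p → ((i : Fin (suc m)) → P (p i)) × AffIndep p)

-- the inequality ℓ(x) ≥ b defines a facet of P:
-- it is valid for P and the face {x ∈ P : ℓ(x) = b} has dimension dim P - 1
FacetDefining : {E : Set} → ((E → ℚ) → Set) → ((E → ℚ) → ℚ) → ℚ → Set
FacetDefining P ℓ b =
  (∀ x → P x → b ≤ ℓ x) ×
  ∃ λ m → AffRank P (suc m) × AffRank (λ x → P x × ℓ x ≡ b) m

record Graph : Set₁ where
  field
    V    : Set
    E    : Set
    ends : E → V × V

module _ (G : Graph) where
  open Graph G

  -- connectivity in G - δ (δ e ≡ true means e ∈ δ)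
  data Conn (δ : E → Bool) : V → V → Set where
    here : ∀ {u} → Conn δ u u
    step : ∀ {u w z} (e : E) → δ e ≡ false →
           (ends e ≡ (u , w) ⊎ ends e ≡ (w , u)) → Conn δ w z → Conn δ u z

  -- δ is an S-multicut, S given as a family of node pairs indexed by I
  IsMulticut : {I : Set} → (I → V × V) → (E → Bool) → Set
  IsMulticut {I} S δ = (i : I) → ¬ Conn δ (proj₁ (S i)) (proj₂ (S i))

  incidence : (E → Bool) → E → ℚ
  incidence δ e = if δ e then 1ℚ else 0ℚ

  MultC□ : {I : Set} → (I → V × V) → (E → ℚ) → Set
  MultC□ S = InConv (λ y → ∃ λ δ → IsMulticut S δ × ((e : E) → y e ≡ incidence δ e))

  MultC : {I : Set} → (I → V × V) → (E → ℚ) → Set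
  MultC S = Dominant (MultC□ S)

  SharedFacet : {I : Set} → (I → V × V) → ((E → ℚ) → ℚ) → ℚ → Set
  SharedFacet S ℓ b = FacetDefining (MultC S) ℓ b × FacetDefining (MultC□ S) ℓ b

data TNode (n : ℕ) : Set where
  root : TNode n
  v    : Fin n → TNode n
  s    : (i j : Fin n) → i < j → TNode n
  t    : (i j : Fin n) → i < j → TNode n

data TEdge (n : ℕ) : Set where
  e  : Fin n → TEdge n
  eL : (i j : Fin n) → i < j → TEdge n
  fL : (i j : Fin n) → i < j → TEdge n

tEnds : {n : ℕ} → TEdge n → TNode n × TNode n
tEnds (e i)        = root , v i
tEnds (eL i j p)   = v i , s i j p
tEnds (fL i j p)   = v j , t i j p

T : ℕ → Graph
T n = record { V = TNode n ; E = TEdge n ; ends = tEnds }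

Pairs : ℕ → Set
Pairs n = Σ (Fin n × Fin n) λ q → proj₁ q < proj₂ q

Sn : (n : ℕ) → Pairs n → TNode n × TNode n
Sn n ((i , j) , p) = s i j p , t i j p

L₂term : {n : ℕ} → (TEdge n → ℚ) → Fin n → Fin n → ℚ
L₂term x i j with i <? j
... | yes p = x (eL i j p) + x (fL i j p)
... | no  _ = 0ℚ

ℕtoℚ : ℕ → ℚ
ℕtoℚ m = + m / 1

lhs : (n k : ℕ) → (TEdge n → ℚ) → ℚ
lhs n k x = ℕtoℚ (n ∸ k) * ΣFin n (λ i → x (e i))
          + ΣFin n (λ i → ΣFin n (λ j → L₂term x i j))

rhs : (n k : ℕ) → ℚ
rhs n k = ℕtoℚ (k ℕ.* (n ∸ k) ℕ.+ ((n ∸ k) C 2))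

-- Validity: if a multicut cuts the edges e_i for i ∈ C, each pair {i, j} disjoint from C still needs e_{i,j} or
-- f_{i,j}, so the left-hand side is at least (n - k)|C| + C(n - |C|, 2), a convex function of |C| whose minimum
-- k(n - k) + C(n - k, 2) is attained exactly at |C| ∈ {k - 1, k}.
-- Dimension: the all-ones point and, for each edge, the point cutting all other edges are affinely independent
-- multicuts. A tight multicut is given by its set D of kept nodes v_i, of size n - k or n - k + 1, and a choice of
-- e_{i,j} or f_{i,j} for each pair inside D. We pick one tight point per edge and an affine form per point which is
-- 1 on it and 0 on all points of the same or a higher rank; such a triangular family is affinely independent.
-- Upper bounds on the rank come from Gaussian elimination, using for the face that it lies in a hyperplane.

module Submission where

open import Defs
open import Data.Nat as ℕ using (ℕ; zero; suc; _∸_; _⊔_; _<ᵇ_; _≡ᵇ_; z≤n; s≤s)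
import Data.Nat.Properties as ℕ
open import Data.Nat.Combinatorics using (_C_; nC1≡n; nCk+nC[k+1]≡[n+1]C[k+1])
open import Data.Nat.Tactic.RingSolver using (solve-∀)
import Data.Nat.Coprimality as Coprime
import Data.Integer as ℤ
import Data.Integer.Properties as ℤ
open import Data.Rational using (ℚ; 0ℚ; 1ℚ; _+_; _*_; _-_; -_; _≤_; _/_; 1/_; mkℚ; ≢-nonZero; *≤*; nonNegative)
open import Data.Rational.Properties hiding (_<?_; _≟_)
import Data.Rational.Properties as ℚ
open import Data.Rational.Solver using (module +-*-Solver)
open +-*-Solver using (solve; _:+_; _:*_; _:-_; :-_; _:=_; con)
open import Data.Fin using (Fin; zero; suc; toℕ; _<_; combine; remQuot; punchIn; punchOut)
open import Data.Fin.Properties using (_<?_)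
import Data.Fin.Properties as Fin
open import Data.Bool using (Bool; true; false; not; _∧_; _∨_; if_then_else_)
open import Data.Bool.Properties using (∨-zeroʳ; ∧-zeroʳ; ∧-conicalˡ; ∧-conicalʳ; ¬-not; not-injective)
open import Data.Product using (Σ; ∃; _×_; _,_; proj₁; proj₂; uncurry)
open import Data.Sum using (_⊎_; inj₁; inj₂)
open import Data.Empty using (⊥-elim)
open import Function using (_∘_)
open import Relation.Nullary using (¬_; yes; no; ¬?; does)
open import Relation.Binary.Definitions using (tri<; tri≈; tri>)
open import Relation.Binary.PropositionalEquality
open ≡-Reasoning

ΣFin-cong : ∀ m {f g : Fin m → ℚ} → (∀ i → f i ≡ g i) → ΣFin m f ≡ ΣFin m g
ΣFin-cong zero    f≡g = refl
ΣFin-cong (suc m) f≡g = cong₂ _+_ (f≡g zero) (ΣFin-cong m (f≡g ∘ suc))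

ΣFin-0 : ∀ m {f : Fin m → ℚ} → (∀ i → f i ≡ 0ℚ) → ΣFin m f ≡ 0ℚ
ΣFin-0 zero    f≡0 = refl
ΣFin-0 (suc m) f≡0 = cong₂ _+_ (f≡0 zero) (ΣFin-0 m (λ i → f≡0 (suc i)))

ΣFin-+ : ∀ m (f g : Fin m → ℚ) → ΣFin m (λ i → f i + g i) ≡ ΣFin m f + ΣFin m g
ΣFin-+ zero    f g = refl
ΣFin-+ (suc m) f g = begin
  f zero + g zero + ΣFin m (λ i → f (suc i) + g (suc i))
    ≡⟨ cong (f zero + g zero +_) (ΣFin-+ m (λ i → f (suc i)) (λ i → g (suc i))) ⟩
  f zero + g zero + (F + G)
    ≡⟨ solve 4 (λ a b c d → a :+ b :+ (c :+ d) := a :+ c :+ (b :+ d)) refl (f zero) (g zero) F G ⟩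
  f zero + F + (g zero + G) ∎
  where
  F = ΣFin m (λ i → f (suc i))
  G = ΣFin m (λ i → g (suc i))

ΣFin-*ˡ : ∀ m c (f : Fin m → ℚ) → ΣFin m (λ i → c * f i) ≡ c * ΣFin m f
ΣFin-*ˡ zero    c f = sym (*-zeroʳ c)
ΣFin-*ˡ (suc m) c f = trans (cong (c * f zero +_) (ΣFin-*ˡ m c (λ i → f (suc i))))
                            (sym (*-distribˡ-+ c (f zero) _))

ΣFin-comm : ∀ m m′ (f : Fin m → Fin m′ → ℚ) →
            ΣFin m (λ i → ΣFin m′ (f i)) ≡ ΣFin m′ (λ j → ΣFin m (λ i → f i j))
ΣFin-comm zero    m′ f = sym (ΣFin-0 m′ (λ _ → refl))
ΣFin-comm (suc m) m′ f = trans (cong (ΣFin m′ (f zero) +_) (ΣFin-comm m m′ (λ i → f (suc i))))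
                               (sym (ΣFin-+ m′ (f zero) _))

ΣFin-mono : ∀ m {f g : Fin m → ℚ} → (∀ i → f i ≤ g i) → ΣFin m f ≤ ΣFin m g
ΣFin-mono zero    f≤g = ≤-refl
ΣFin-mono (suc m) f≤g = +-mono-≤ (f≤g zero) (ΣFin-mono m (λ i → f≤g (suc i)))

ΣFin-single : ∀ m (f : Fin m → ℚ) g → (∀ i → i ≢ g → f i ≡ 0ℚ) → ΣFin m f ≡ f g
ΣFin-single (suc m) f zero    f≡0 =
  trans (cong (f zero +_) (ΣFin-0 m (λ i → f≡0 (suc i) λ ()))) (+-identityʳ _)
ΣFin-single (suc m) f (suc g) f≡0 =
  trans (cong₂ _+_ (f≡0 zero λ ())
                   (ΣFin-single m (λ i → f (suc i)) g (λ i i≢g → f≡0 (suc i) (i≢g ∘ Fin.suc-injective))))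
        (+-identityˡ _)

ℕtoℚ-suc : ∀ m → ℕtoℚ (suc m) ≡ 1ℚ + ℕtoℚ m
ℕtoℚ-suc m = trans (cong (_/ 1) (sym numerator)) (cong (1ℚ +_) (sym normalized))
  where
  normalized : ℕtoℚ m ≡ mkℚ (ℤ.+ m) 0 (Coprime.sym (Coprime.1-coprimeTo m))
  normalized = normalize-coprime _
  numerator : ℤ.+ 1 ℤ.* ℤ.+ 1 ℤ.+ ℤ.+ m ℤ.* ℤ.+ 1 ≡ ℤ.+ suc m
  numerator = cong (λ z → ℤ.+ 1 ℤ.+ z) (ℤ.*-identityʳ (ℤ.+ m))

ℕtoℚ-+ : ∀ a b → ℕtoℚ (a ℕ.+ b) ≡ ℕtoℚ a + ℕtoℚ b
ℕtoℚ-+ zero    b = sym (+-identityˡ (ℕtoℚ b))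
ℕtoℚ-+ (suc a) b = begin
  ℕtoℚ (suc (a ℕ.+ b))        ≡⟨ ℕtoℚ-suc (a ℕ.+ b) ⟩
  1ℚ + ℕtoℚ (a ℕ.+ b)         ≡⟨ cong (1ℚ +_) (ℕtoℚ-+ a b) ⟩
  1ℚ + (ℕtoℚ a + ℕtoℚ b)      ≡⟨ sym (+-assoc 1ℚ (ℕtoℚ a) (ℕtoℚ b)) ⟩
  1ℚ + ℕtoℚ a + ℕtoℚ b        ≡⟨ cong (_+ ℕtoℚ b) (sym (ℕtoℚ-suc a)) ⟩
  ℕtoℚ (suc a) + ℕtoℚ b       ∎

ℕtoℚ-* : ∀ a b → ℕtoℚ (a ℕ.* b) ≡ ℕtoℚ a * ℕtoℚ b
ℕtoℚ-* zero    b = sym (*-zeroˡ (ℕtoℚ b))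
ℕtoℚ-* (suc a) b = begin
  ℕtoℚ (b ℕ.+ a ℕ.* b)        ≡⟨ ℕtoℚ-+ b (a ℕ.* b) ⟩
  ℕtoℚ b + ℕtoℚ (a ℕ.* b)     ≡⟨ cong (ℕtoℚ b +_) (ℕtoℚ-* a b) ⟩
  ℕtoℚ b + ℕtoℚ a * ℕtoℚ b    ≡⟨ solve 2 (λ x y → y :+ x :* y := (con 1ℚ :+ x) :* y)
                                         refl (ℕtoℚ a) (ℕtoℚ b) ⟩
  (1ℚ + ℕtoℚ a) * ℕtoℚ b      ≡⟨ cong (_* ℕtoℚ b) (sym (ℕtoℚ-suc a)) ⟩
  ℕtoℚ (suc a) * ℕtoℚ b       ∎

0≤1 : 0ℚ ≤ 1ℚ
0≤1 = *≤* (ℤ.+≤+ ℕ.z≤n)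

ℕtoℚ-nonNeg : ∀ a → 0ℚ ≤ ℕtoℚ a
ℕtoℚ-nonNeg zero    = ≤-refl
ℕtoℚ-nonNeg (suc a) = subst (0ℚ ≤_) (sym (ℕtoℚ-suc a)) (+-mono-≤ 0≤1 (ℕtoℚ-nonNeg a))

ℕtoℚ-mono : ∀ {a b} → a ℕ.≤ b → ℕtoℚ a ≤ ℕtoℚ b
ℕtoℚ-mono {a} {b} a≤b =
  subst₂ _≤_ (+-identityʳ (ℕtoℚ a)) (trans (sym (ℕtoℚ-+ a (b ℕ.∸ a))) (cong ℕtoℚ (ℕ.m+[n∸m]≡n a≤b)))
         (+-monoʳ-≤ (ℕtoℚ a) (ℕtoℚ-nonNeg (b ℕ.∸ a)))

ℕtoℚ-suc≢0 : ∀ a → ℕtoℚ (suc a) ≢ 0ℚ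
ℕtoℚ-suc≢0 a eq = 1≰0 (subst (1ℚ ≤_) (trans (sym (ℕtoℚ-suc a)) eq) 1≤1+a)
  where
  1≰0 : ¬ 1ℚ ≤ 0ℚ
  1≰0 (*≤* (ℤ.+≤+ ()))
  1≤1+a : 1ℚ ≤ 1ℚ + ℕtoℚ a
  1≤1+a = subst (_≤ 1ℚ + ℕtoℚ a) (+-identityʳ 1ℚ) (+-monoʳ-≤ 1ℚ (ℕtoℚ-nonNeg a))

𝟙 : Bool → ℚ
𝟙 b = if b then 1ℚ else 0ℚ

𝟙-nonNeg : ∀ b → 0ℚ ≤ 𝟙 b
𝟙-nonNeg true  = 0≤1
𝟙-nonNeg false = ≤-refl

𝟙≤1 : ∀ b → 𝟙 b ≤ 1ℚ
𝟙≤1 true  = ≤-refl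
𝟙≤1 false = 0≤1

≤-+𝟙 : ∀ p b → p ≤ p + 𝟙 b
≤-+𝟙 p b = subst (_≤ p + 𝟙 b) (+-identityʳ p) (+-monoʳ-≤ p (𝟙-nonNeg b))

*-cancelˡ-0 : ∀ c {q} → c ≢ 0ℚ → c * q ≡ 0ℚ → q ≡ 0ℚ
*-cancelˡ-0 c {q} c≢0 cq≡0 = begin
  q                  ≡⟨ sym (*-identityˡ q) ⟩
  1ℚ * q             ≡⟨ cong (_* q) (sym (*-inverseˡ c {{≢-nonZero c≢0}})) ⟩
  (c⁻¹ * c) * q      ≡⟨ *-assoc c⁻¹ c q ⟩
  c⁻¹ * (c * q)      ≡⟨ cong (c⁻¹ *_) cq≡0 ⟩
  c⁻¹ * 0ℚ           ≡⟨ *-zeroʳ c⁻¹ ⟩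
  0ℚ                 ∎
  where
  c⁻¹ = 1/_ c {{≢-nonZero c≢0}}

ΣFin-sub-* : ∀ m (a b μ : Fin m → ℚ) c →
  ΣFin m (λ i → (a i - c * b i) * μ i) ≡ ΣFin m (λ i → a i * μ i) - c * ΣFin m (λ i → b i * μ i)
ΣFin-sub-* m a b μ c = begin
  ΣFin m (λ i → (a i - c * b i) * μ i)
    ≡⟨ ΣFin-cong m (λ i → solve 4 (λ x y z w → (x :- z :* y) :* w := x :* w :+ (:- z) :* (y :* w))
                                   refl (a i) (b i) c (μ i)) ⟩
  ΣFin m (λ i → a i * μ i + (- c) * (b i * μ i))
    ≡⟨ ΣFin-+ m _ _ ⟩
  ΣFin m (λ i → a i * μ i) + ΣFin m (λ i → (- c) * (b i * μ i))
    ≡⟨ cong (ΣFin m (λ i → a i * μ i) +_) (ΣFin-*ˡ m (- c) _) ⟩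
  ΣFin m (λ i → a i * μ i) + (- c) * ΣFin m (λ i → b i * μ i)
    ≡⟨ solve 3 (λ x y z → x :+ (:- y) :* z := x :- y :* z)
               refl (ΣFin m (λ i → a i * μ i)) c (ΣFin m (λ i → b i * μ i)) ⟩
  ΣFin m (λ i → a i * μ i) - c * ΣFin m (λ i → b i * μ i) ∎

-- Gaussian elimination: a pivot in the first column eliminates the first unknown; without one, the first
-- unit vector is a solution.
homogeneous-nontrivial : ∀ m (A : Fin m → Fin (suc m) → ℚ) →
  Σ (Fin (suc m) → ℚ) λ μ → (∃ λ i → μ i ≢ 0ℚ) × (∀ r → ΣFin (suc m) (λ i → A r i * μ i) ≡ 0ℚ)
homogeneous-nontrivial zero    A = (λ _ → 1ℚ) , (zero , λ ()) , λ ()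
homogeneous-nontrivial (suc m) A with Fin.any? (λ r → ¬? (A r zero ℚ.≟ 0ℚ))
... | no noPivot = μ , (zero , λ ()) , solves
  where
  μ : Fin (suc (suc m)) → ℚ
  μ zero    = 1ℚ
  μ (suc _) = 0ℚ
  column₀≡0 : ∀ r → A r zero ≡ 0ℚ
  column₀≡0 r with A r zero ℚ.≟ 0ℚ
  ... | yes A₀≡0 = A₀≡0
  ... | no  A₀≢0 = ⊥-elim (noPivot (r , A₀≢0))
  solves : ∀ r → ΣFin (suc (suc m)) (λ i → A r i * μ i) ≡ 0ℚ
  solves r = trans (cong₂ _+_ (trans (*-identityʳ _) (column₀≡0 r))
                              (ΣFin-0 (suc m) (λ i → *-zeroʳ (A r (suc i)))))
                   (+-identityʳ 0ℚ)
... | yes (r₀ , pivot≢0) = μ , (suc (proj₁ μ′≢0) , proj₂ μ′≢0) , solves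
  where
  pivot = A r₀ zero
  q = 1/_ pivot {{≢-nonZero pivot≢0}}
  reduced : Fin m → Fin (suc m) → ℚ
  reduced r′ i = A (punchIn r₀ r′) (suc i) - A (punchIn r₀ r′) zero * q * A r₀ (suc i)
  IH = homogeneous-nontrivial m reduced
  μ′ = proj₁ IH
  μ′≢0 = proj₁ (proj₂ IH)
  S₀ = ΣFin (suc m) (λ i → A r₀ (suc i) * μ′ i)
  μ : Fin (suc (suc m)) → ℚ
  μ zero    = - (q * S₀)
  μ (suc i) = μ′ i
  solves : ∀ r → ΣFin (suc (suc m)) (λ i → A r i * μ i) ≡ 0ℚ
  solves r with r Fin.≟ r₀
  ... | yes refl = begin
    pivot * - (q * S₀) + S₀   ≡⟨ solve 3 (λ x y σ → x :* (:- (y :* σ)) :+ σ := σ :- (x :* y) :* σ)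
                                         refl pivot q S₀ ⟩
    S₀ - pivot * q * S₀       ≡⟨ cong (λ t → S₀ - t * S₀) (*-inverseʳ pivot {{≢-nonZero pivot≢0}}) ⟩
    S₀ - 1ℚ * S₀              ≡⟨ solve 1 (λ σ → σ :- con 1ℚ :* σ := con 0ℚ) refl S₀ ⟩
    0ℚ                        ∎
  ... | no r≢r₀ = begin
    A r zero * - (q * S₀) + ΣFin (suc m) (λ i → A r (suc i) * μ′ i)
      ≡⟨ solve 4 (λ a y σ τ → a :* (:- (y :* σ)) :+ τ := τ :- a :* y :* σ) refl (A r zero) q S₀ _ ⟩
    ΣFin (suc m) (λ i → A r (suc i) * μ′ i) - A r zero * q * S₀
      ≡⟨ cong (λ t → ΣFin (suc m) (λ i → A t (suc i) * μ′ i) - A t zero * q * S₀) (sym punch) ⟩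
    ΣFin (suc m) (λ i → A (punchIn r₀ r′) (suc i) * μ′ i) - A (punchIn r₀ r′) zero * q * S₀
      ≡⟨ sym (ΣFin-sub-* (suc m) (λ i → A (punchIn r₀ r′) (suc i)) (λ i → A r₀ (suc i)) μ′
                         (A (punchIn r₀ r′) zero * q)) ⟩
    ΣFin (suc m) (λ i → reduced r′ i * μ′ i)
      ≡⟨ proj₂ (proj₂ IH) r′ ⟩
    0ℚ ∎
    where
    r′ = punchOut (r≢r₀ ∘ sym)
    punch : punchIn r₀ r′ ≡ r
    punch = Fin.punchIn-punchOut (r≢r₀ ∘ sym)

¬affIndep-underdetermined : {E : Set} {m : ℕ} (p : Fin (suc m) → E → ℚ) (A : Fin m → Fin (suc m) → ℚ) →
  (∀ μ → (∀ r → ΣFin (suc m) (λ i → A r i * μ i) ≡ 0ℚ) →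
         ΣFin (suc m) μ ≡ 0ℚ × (∀ e → ΣFin (suc m) (λ i → μ i * p i e) ≡ 0ℚ)) →
  ¬ AffIndep p
¬affIndep-underdetermined {m = m} p A relation indep with homogeneous-nontrivial m A
... | μ , (i , μi≢0) , solves = μi≢0 (indep μ (proj₁ rel) (proj₂ rel) i)
  where rel = relation μ solves

¬affIndep-full : {E : Set} {d : ℕ} (enum : Fin d → E) → (∀ e → ∃ λ g → enum g ≡ e) →
  (p : Fin (suc (suc d)) → E → ℚ) → ¬ AffIndep p
¬affIndep-full {d = d} enum onto p = ¬affIndep-underdetermined p A relation
  where
  A : Fin (suc d) → Fin (suc (suc d)) → ℚ
  A zero    i = 1ℚ
  A (suc g) i = p i (enum g)
  relation : ∀ μ → (∀ r → ΣFin (suc (suc d)) (λ i → A r i * μ i) ≡ 0ℚ) →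
             ΣFin (suc (suc d)) μ ≡ 0ℚ × (∀ e → ΣFin (suc (suc d)) (λ i → μ i * p i e) ≡ 0ℚ)
  relation μ solves = trans (ΣFin-cong _ (λ i → sym (*-identityˡ (μ i)))) (solves zero) , coordinate
    where
    coordinate : ∀ e → ΣFin (suc (suc d)) (λ i → μ i * p i e) ≡ 0ℚ
    coordinate x with onto x
    ... | g , refl = trans (ΣFin-cong _ (λ i → *-comm (μ i) (p i (enum g)))) (solves (suc g))

¬affIndep-hyperplane : {E : Set} {d : ℕ} (enum : Fin (suc d) → E) → (∀ e → ∃ λ g → enum g ≡ e) →
  (p : Fin (suc (suc d)) → E → ℚ) →
  (∀ μ → ΣFin (suc (suc d)) μ ≡ 0ℚ → (∀ g → ΣFin (suc (suc d)) (λ i → μ i * p i (enum (suc g))) ≡ 0ℚ) →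
         ΣFin (suc (suc d)) (λ i → μ i * p i (enum zero)) ≡ 0ℚ) →
  ¬ AffIndep p
¬affIndep-hyperplane {d = d} enum onto p determined = ¬affIndep-underdetermined p A relation
  where
  A : Fin (suc d) → Fin (suc (suc d)) → ℚ
  A zero    i = 1ℚ
  A (suc g) i = p i (enum (suc g))
  relation : ∀ μ → (∀ r → ΣFin (suc (suc d)) (λ i → A r i * μ i) ≡ 0ℚ) →
             ΣFin (suc (suc d)) μ ≡ 0ℚ × (∀ e → ΣFin (suc (suc d)) (λ i → μ i * p i e) ≡ 0ℚ)
  relation μ solves = Σμ≡0 , coordinate
    where
    Σμ≡0 = trans (ΣFin-cong _ (λ i → sym (*-identityˡ (μ i)))) (solves zero)
    other : ∀ g → ΣFin (suc (suc d)) (λ i → μ i * p i (enum (suc g))) ≡ 0ℚ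
    other g = trans (ΣFin-cong _ (λ i → *-comm (μ i) (p i (enum (suc g))))) (solves (suc g))
    coordinate : ∀ e → ΣFin (suc (suc d)) (λ i → μ i * p i e) ≡ 0ℚ
    coordinate x with onto x
    ... | zero  , refl = determined μ Σμ≡0 other
    ... | suc g , refl = other g

infixl 6 _⊕_
data Affine (E : Set) : Set where
  const : ℚ → Affine E
  coord : ℚ → E → Affine E
  _⊕_   : Affine E → Affine E → Affine E

⟦_⟧ : {E : Set} → Affine E → (E → ℚ) → ℚ
⟦ const c   ⟧ x = c
⟦ coord w ε ⟧ x = w * x ε
⟦ φ ⊕ ψ     ⟧ x = ⟦ φ ⟧ x + ⟦ ψ ⟧ x

Σ-⟦⟧ : {E : Set} {M : ℕ} (μ : Fin M → ℚ) (p : Fin M → E → ℚ) →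
       ΣFin M μ ≡ 0ℚ → (∀ e → ΣFin M (λ i → μ i * p i e) ≡ 0ℚ) →
       ∀ φ → ΣFin M (λ i → μ i * ⟦ φ ⟧ (p i)) ≡ 0ℚ
Σ-⟦⟧ {M = M} μ p Σμ≡0 Σμp≡0 (const c) = begin
  ΣFin M (λ i → μ i * c)   ≡⟨ ΣFin-cong M (λ i → *-comm (μ i) c) ⟩
  ΣFin M (λ i → c * μ i)   ≡⟨ ΣFin-*ˡ M c μ ⟩
  c * ΣFin M μ             ≡⟨ cong (c *_) Σμ≡0 ⟩
  c * 0ℚ                   ≡⟨ *-zeroʳ c ⟩
  0ℚ                       ∎
Σ-⟦⟧ {M = M} μ p Σμ≡0 Σμp≡0 (coord w x) = begin
  ΣFin M (λ i → μ i * (w * p i x))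
    ≡⟨ ΣFin-cong M (λ i → solve 3 (λ a b c → a :* (b :* c) := b :* (a :* c)) refl (μ i) w (p i x)) ⟩
  ΣFin M (λ i → w * (μ i * p i x))   ≡⟨ ΣFin-*ˡ M w _ ⟩
  w * ΣFin M (λ i → μ i * p i x)     ≡⟨ cong (w *_) (Σμp≡0 x) ⟩
  w * 0ℚ                             ≡⟨ *-zeroʳ w ⟩
  0ℚ                                 ∎
Σ-⟦⟧ {M = M} μ p Σμ≡0 Σμp≡0 (φ ⊕ ψ) = begin
  ΣFin M (λ i → μ i * (⟦ φ ⟧ (p i) + ⟦ ψ ⟧ (p i)))
    ≡⟨ ΣFin-cong M (λ i → *-distribˡ-+ (μ i) _ _) ⟩
  ΣFin M (λ i → μ i * ⟦ φ ⟧ (p i) + μ i * ⟦ ψ ⟧ (p i))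
    ≡⟨ ΣFin-+ M _ _ ⟩
  ΣFin M (λ i → μ i * ⟦ φ ⟧ (p i)) + ΣFin M (λ i → μ i * ⟦ ψ ⟧ (p i))
    ≡⟨ cong₂ _+_ (Σ-⟦⟧ μ p Σμ≡0 Σμp≡0 φ) (Σ-⟦⟧ μ p Σμ≡0 Σμp≡0 ψ) ⟩
  0ℚ + 0ℚ ≡⟨ +-identityʳ 0ℚ ⟩
  0ℚ ∎

affIndep-triangular : {E : Set} {M : ℕ} (p : Fin M → E → ℚ) (rank : Fin M → ℕ) (φ : Fin M → Affine E) →
  (∀ g → ⟦ φ g ⟧ (p g) ≡ 1ℚ) →
  (∀ g h → g ≢ h → rank g ℕ.≤ rank h → ⟦ φ g ⟧ (p h) ≡ 0ℚ) →
  AffIndep p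
affIndep-triangular {M = M} p rank φ own separates μ Σμ≡0 Σμp≡0 g = vanishBelow (suc (rank g)) g ℕ.≤-refl
  where
  vanish : ∀ g → (∀ h → rank h ℕ.< rank g → μ h ≡ 0ℚ) → μ g ≡ 0ℚ
  vanish g lower = begin
    μ g                                   ≡⟨ sym (*-identityʳ (μ g)) ⟩
    μ g * 1ℚ                              ≡⟨ cong (μ g *_) (sym (own g)) ⟩
    μ g * ⟦ φ g ⟧ (p g)                   ≡⟨ sym (ΣFin-single M (λ h → μ h * ⟦ φ g ⟧ (p h)) g others) ⟩
    ΣFin M (λ h → μ h * ⟦ φ g ⟧ (p h))    ≡⟨ Σ-⟦⟧ μ p Σμ≡0 Σμp≡0 (φ g) ⟩
    0ℚ                                    ∎
    where
    others : ∀ h → h ≢ g → μ h * ⟦ φ g ⟧ (p h) ≡ 0ℚ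
    others h h≢g with rank h ℕ.<? rank g
    ... | yes below = trans (cong (_* ⟦ φ g ⟧ (p h)) (lower h below)) (*-zeroˡ (⟦ φ g ⟧ (p h)))
    ... | no  above = trans (cong (μ h *_) (separates g h (h≢g ∘ sym) (ℕ.≮⇒≥ above))) (*-zeroʳ (μ h))
  vanishBelow : ∀ r h → rank h ℕ.< r → μ h ≡ 0ℚ
  vanishBelow (suc r) h (ℕ.s≤s rank≤r) with ℕ.m≤n⇒m<n∨m≡n rank≤r
  ... | inj₁ below = vanishBelow r h below
  ... | inj₂ rank≡r = vanish h (λ h′ below → vanishBelow r h′ (subst (rank h′ ℕ.<_) rank≡r below))

true≢false : true ≢ false
true≢false ()

Conn-invariant : (G : Graph) → let open Graph G in
  {A : Set} (δ : E → Bool) (ℓ : V → A) →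
  (∀ ε → δ ε ≡ false → ℓ (proj₁ (ends ε)) ≡ ℓ (proj₂ (ends ε))) →
  ∀ {u w} → Conn G δ u w → ℓ u ≡ ℓ w
Conn-invariant G δ ℓ stable here = refl
Conn-invariant G δ ℓ stable (step ε δε≡false (inj₁ ends≡) conn) =
  trans (trans (cong (ℓ ∘ proj₁) (sym ends≡)) (stable ε δε≡false))
        (trans (cong (ℓ ∘ proj₂) ends≡) (Conn-invariant G δ ℓ stable conn))
Conn-invariant G δ ℓ stable (step ε δε≡false (inj₂ ends≡) conn) =
  trans (trans (cong (ℓ ∘ proj₂) (sym ends≡)) (sym (stable ε δε≡false)))
        (trans (cong (ℓ ∘ proj₁) ends≡) (Conn-invariant G δ ℓ stable conn))

module _ {n : ℕ} where

  edgeAt : Fin n → Fin n → TEdge n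
  edgeAt i j with Fin.<-cmp i j
  ... | tri< i<j _ _ = eL i j i<j
  ... | tri≈ _ _ _   = e i
  ... | tri> _ _ j<i = fL j i j<i

  edgeAt-e : ∀ i → edgeAt i i ≡ e i
  edgeAt-e i with Fin.<-cmp i i
  ... | tri< i<i _ _ = ⊥-elim (ℕ.<-irrefl refl i<i)
  ... | tri≈ _ _ _   = refl
  ... | tri> _ _ i<i = ⊥-elim (ℕ.<-irrefl refl i<i)

  edgeAt-eL : ∀ i j p → edgeAt i j ≡ eL i j p
  edgeAt-eL i j p with Fin.<-cmp i j
  ... | tri< q _ _ = cong (eL i j) (Fin.<-irrelevant q p)
  ... | tri≈ _ refl _ = ⊥-elim (ℕ.<-irrefl refl p)
  ... | tri> _ _ q = ⊥-elim (ℕ.<-asym p q)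

  edgeAt-fL : ∀ i j p → edgeAt j i ≡ fL i j p
  edgeAt-fL i j p with Fin.<-cmp j i
  ... | tri< q _ _ = ⊥-elim (ℕ.<-asym p q)
  ... | tri≈ _ refl _ = ⊥-elim (ℕ.<-irrefl refl p)
  ... | tri> _ _ q = cong (fL i j) (Fin.<-irrelevant q p)

  -- the edges of T n, listed along the n × n grid: e i on the diagonal, eL above, fL below
  edge : Fin (n ℕ.* n) → TEdge n
  edge g = uncurry edgeAt (remQuot n g)

  index : TEdge n → Fin (n ℕ.* n)
  index (e i)      = combine i i
  index (eL i j _) = combine i j
  index (fL i j _) = combine j i

  edge-index : ∀ ε → edge (index ε) ≡ ε
  edge-index (e i)      = trans (cong (uncurry edgeAt) (Fin.remQuot-combine i i)) (edgeAt-e i)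
  edge-index (eL i j p) = trans (cong (uncurry edgeAt) (Fin.remQuot-combine i j)) (edgeAt-eL i j p)
  edge-index (fL i j p) = trans (cong (uncurry edgeAt) (Fin.remQuot-combine j i)) (edgeAt-fL i j p)

  index-edgeAt : ∀ i j → index (edgeAt i j) ≡ combine i j
  index-edgeAt i j with Fin.<-cmp i j
  ... | tri< _ _ _    = refl
  ... | tri≈ _ refl _ = refl
  ... | tri> _ _ _    = refl

  index-edge : ∀ g → index (edge g) ≡ g
  index-edge g = trans (uncurry index-edgeAt (remQuot n g)) (Fin.combine-remQuot {n} n g)

  edge-onto : ∀ ε → ∃ λ g → edge g ≡ ε
  edge-onto ε = index ε , edge-index ε

  index-injective : ∀ {ε ε′} → index ε ≡ index ε′ → ε ≡ ε′
  index-injective {ε} {ε′} eq = trans (sym (edge-index ε)) (trans (cong edge eq) (edge-index ε′))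

  edge-injective : ∀ {g h} → g ≢ h → edge g ≢ edge h
  edge-injective {g} {h} g≢h eq = g≢h (trans (sym (index-edge g)) (trans (cong index eq) (index-edge h)))

  e-≢ : ∀ {z z′ : Fin n} → e z ≢ e z′ → toℕ z ≢ toℕ z′
  e-≢ ne z≡z′ = ne (cong e (Fin.toℕ-injective z≡z′))

  eL-≢ : ∀ {y z y′ z′ : Fin n} {p p′} → eL y z p ≢ eL y′ z′ p′ → ¬ (toℕ y ≡ toℕ y′ × toℕ z ≡ toℕ z′)
  eL-≢ ne (y≡y′ , z≡z′) with Fin.toℕ-injective y≡y′ | Fin.toℕ-injective z≡z′
  ... | refl | refl = ne (cong (eL _ _) (Fin.<-irrelevant _ _))

  fL-≢ : ∀ {y z y′ z′ : Fin n} {p p′} → fL y z p ≢ fL y′ z′ p′ → ¬ (toℕ y ≡ toℕ y′ × toℕ z ≡ toℕ z′)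
  fL-≢ ne (y≡y′ , z≡z′) with Fin.toℕ-injective y≡y′ | Fin.toℕ-injective z≡z′
  ... | refl | refl = ne (cong (fL _ _) (Fin.<-irrelevant _ _))

  _==_ : Fin n → Fin n → Bool
  a == b = does (a Fin.≟ b)

  ==-refl : ∀ a → (a == a) ≡ true
  ==-refl a with a Fin.≟ a
  ... | yes _   = refl
  ... | no  a≢a = ⊥-elim (a≢a refl)

  ==-≢ : ∀ {a b} → a ≢ b → (a == b) ≡ false
  ==-≢ {a} {b} a≢b with a Fin.≟ b
  ... | yes a≡b = ⊥-elim (a≢b a≡b)
  ... | no  _   = refl

  -- the subtree hanging from ε
  below : TEdge n → TNode n → Bool
  below (e i)      (v a)     = a == i
  below (e i)      (s a _ _) = a == i
  below (e i)      (t _ b _) = b == i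
  below (eL i j _) (s a b _) = (a == i) ∧ (b == j)
  below (fL i j _) (t a b _) = (a == i) ∧ (b == j)
  below _          _         = false

  below-stable : ∀ ε ε′ → ε′ ≢ ε → below ε (proj₁ (tEnds ε′)) ≡ below ε (proj₂ (tEnds ε′))
  below-stable (e i)      (e a)      ε′≢ε = sym (==-≢ {a} {i} (λ { refl → ε′≢ε refl }))
  below-stable (e i)      (eL a b q) ε′≢ε = refl
  below-stable (e i)      (fL a b q) ε′≢ε = refl
  below-stable (eL i j p) (e a)      ε′≢ε = refl
  below-stable (eL i j p) (eL a b q) ε′≢ε with a Fin.≟ i | b Fin.≟ j
  ... | yes refl | yes refl = ⊥-elim (ε′≢ε (cong (eL a b) (Fin.<-irrelevant q p)))
  ... | yes _    | no  _    = refl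
  ... | no  _    | _        = refl
  below-stable (eL i j p) (fL a b q) ε′≢ε = refl
  below-stable (fL i j p) (e a)      ε′≢ε = refl
  below-stable (fL i j p) (eL a b q) ε′≢ε = refl
  below-stable (fL i j p) (fL a b q) ε′≢ε with a Fin.≟ i | b Fin.≟ j
  ... | yes refl | yes refl = ⊥-elim (ε′≢ε (cong (fL a b) (Fin.<-irrelevant q p)))
  ... | yes _    | no  _    = refl
  ... | no  _    | _        = refl

  -- e_{i,j}, e_i, e_j, f_{i,j} form the path from s_{i,j} to t_{i,j}
  CutsPaths : (TEdge n → Bool) → Set
  CutsPaths δ = ∀ i j p → δ (eL i j p) ≡ true ⊎ δ (e i) ≡ true ⊎ δ (e j) ≡ true ⊎ δ (fL i j p) ≡ true

  cut-blocks : ∀ δ {ε} → δ ε ≡ true → ∀ {u w} → Conn (T n) δ u w → below ε u ≡ below ε w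
  cut-blocks δ {ε} cut = Conn-invariant (T n) δ (below ε)
    (λ ε′ uncut → below-stable ε ε′ (λ { refl → true≢false (trans (sym cut) uncut) }))

  cutsPaths⇒multicut : ∀ δ → CutsPaths δ → IsMulticut (T n) (Sn n) δ
  cutsPaths⇒multicut δ cuts ((i , j) , p) conn with cuts i j p
  ... | inj₁ cut =
    true≢false (trans (sym (cong₂ _∧_ (==-refl i) (==-refl j))) (cut-blocks δ cut conn))
  ... | inj₂ (inj₁ cut) =
    true≢false (trans (sym (==-refl i)) (trans (cut-blocks δ cut conn) (==-≢ (ℕ.>⇒≢ p ∘ cong toℕ))))
  ... | inj₂ (inj₂ (inj₁ cut)) =
    true≢false (trans (sym (==-refl j)) (trans (sym (cut-blocks δ cut conn)) (==-≢ (ℕ.<⇒≢ p ∘ cong toℕ))))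
  ... | inj₂ (inj₂ (inj₂ cut)) =
    true≢false (trans (sym (cong₂ _∧_ (==-refl i) (==-refl j))) (sym (cut-blocks δ cut conn)))

  multicut⇒cutsPaths : ∀ δ → IsMulticut (T n) (Sn n) δ → CutsPaths δ
  multicut⇒cutsPaths δ multicut i j p
    with δ (eL i j p) in δeL | δ (e i) in δei | δ (e j) in δej | δ (fL i j p) in δfL
  ... | true  | _     | _     | _     = inj₁ refl
  ... | false | true  | _     | _     = inj₂ (inj₁ refl)
  ... | false | false | true  | _     = inj₂ (inj₂ (inj₁ refl))
  ... | false | false | false | true  = inj₂ (inj₂ (inj₂ refl))
  ... | false | false | false | false = ⊥-elim (multicut ((i , j) , p)
    (step (eL i j p) δeL (inj₂ refl) (step (e i) δei (inj₂ refl)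
      (step (e j) δej (inj₁ refl) (step (fL i j p) δfL (inj₁ refl) here)))))

count : ∀ n → (Fin n → Bool) → ℕ
count zero    f = 0
count (suc n) f = if f zero then suc (count n (f ∘ suc)) else count n (f ∘ suc)

Σ𝟙≡count : ∀ n f → ΣFin n (𝟙 ∘ f) ≡ ℕtoℚ (count n f)
Σ𝟙≡count zero    f = refl
Σ𝟙≡count (suc n) f with f zero
... | true  = trans (cong (1ℚ +_) (Σ𝟙≡count n (f ∘ suc))) (sym (ℕtoℚ-suc (count n (f ∘ suc))))
... | false = trans (+-identityˡ _) (Σ𝟙≡count n (f ∘ suc))

count-not : ∀ n f → count n f ℕ.+ count n (not ∘ f) ≡ n
count-not zero    f = refl
count-not (suc n) f with f zero
... | true  = cong suc (count-not n (f ∘ suc))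
... | false = trans (ℕ.+-suc _ _) (cong suc (count-not n (f ∘ suc)))

interval : ℕ → ℕ → Bool
interval b c = c <ᵇ b

insert : ℕ → (ℕ → Bool) → ℕ → Bool
insert z P c = (c ≡ᵇ z) ∨ P c

remove : ℕ → (ℕ → Bool) → ℕ → Bool
remove z P c = not (c ≡ᵇ z) ∧ P c

≡ᵇ-refl : ∀ c → (c ≡ᵇ c) ≡ true
≡ᵇ-refl zero    = refl
≡ᵇ-refl (suc c) = ≡ᵇ-refl c

≡ᵇ-≢ : ∀ {c z} → c ≢ z → (c ≡ᵇ z) ≡ false
≡ᵇ-≢ {zero}  {zero}  c≢z = ⊥-elim (c≢z refl)
≡ᵇ-≢ {zero}  {suc z} c≢z = refl
≡ᵇ-≢ {suc c} {zero}  c≢z = refl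
≡ᵇ-≢ {suc c} {suc z} c≢z = ≡ᵇ-≢ (c≢z ∘ cong suc)

≡ᵇ-pair : ∀ {a a′ b b′} → ¬ (a ≡ a′ × b ≡ b′) → ((a ≡ᵇ a′) ∧ (b ≡ᵇ b′)) ≡ false
≡ᵇ-pair {a} {a′} {b} {b′} ne with a ℕ.≟ a′
... | no  a≢a′ rewrite ≡ᵇ-≢ a≢a′ = refl
... | yes a≡a′ rewrite a≡a′ | ≡ᵇ-refl a′ = ≡ᵇ-≢ (λ b≡b′ → ne (refl , b≡b′))

same-pair : ∀ {y z y′ z′ : ℕ} → y ℕ.< z → y′ ℕ.< z′ →
            y ≡ y′ ⊎ y ≡ z′ → z ≡ y′ ⊎ z ≡ z′ → y ≡ y′ × z ≡ z′
same-pair y<z y′<z′ (inj₁ refl) (inj₁ refl) = ⊥-elim (ℕ.<-irrefl refl y<z)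
same-pair y<z y′<z′ (inj₁ y≡y′) (inj₂ z≡z′) = y≡y′ , z≡z′
same-pair y<z y′<z′ (inj₂ refl) (inj₁ refl) = ⊥-elim (ℕ.<-asym y<z y′<z′)
same-pair y<z y′<z′ (inj₂ refl) (inj₂ refl) = ⊥-elim (ℕ.<-irrefl refl y<z)

interval-< : ∀ {b c} → c ℕ.< b → interval b c ≡ true
interval-< {suc b} {zero}  _       = refl
interval-< {suc b} {suc c} (s≤s c<b) = interval-< c<b

interval-≥ : ∀ {b c} → b ℕ.≤ c → interval b c ≡ false
interval-≥ {zero}  _         = refl
interval-≥ {suc b} (s≤s b≤c) = interval-≥ b≤c

insert-self : ∀ z P → insert z P z ≡ true
insert-self z P rewrite ≡ᵇ-refl z = refl

insert-⊇ : ∀ z P c → P c ≡ true → insert z P c ≡ true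
insert-⊇ z P c Pc≡true rewrite Pc≡true = ∨-zeroʳ (c ≡ᵇ z)

insert-other : ∀ z P {c} → c ≢ z → insert z P c ≡ P c
insert-other z P c≢z rewrite ≡ᵇ-≢ c≢z = refl

∈insert : ∀ z P c → insert z P c ≡ true → c ≡ z ⊎ P c ≡ true
∈insert z P c c∈ with c ℕ.≟ z
... | yes c≡z = inj₁ c≡z
... | no  c≢z = inj₂ (trans (sym (insert-other z P c≢z)) c∈)

remove-self : ∀ z P → remove z P z ≡ false
remove-self z P rewrite ≡ᵇ-refl z = refl

remove-other : ∀ z P {c} → c ≢ z → remove z P c ≡ P c
remove-other z P c≢z rewrite ≡ᵇ-≢ c≢z = refl

remove-⊆ : ∀ z P c → P c ≡ false → remove z P c ≡ false
remove-⊆ z P c Pc≡false rewrite Pc≡false = ∧-zeroʳ (not (c ≡ᵇ z))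

∉remove : ∀ z P c → remove z P c ≡ false → P c ≡ true → c ≡ z
∉remove z P c c∉ Pc≡true with c ℕ.≟ z
... | yes c≡z = c≡z
... | no  c≢z = ⊥-elim (true≢false (trans (sym Pc≡true) (trans (sym (remove-other z P c≢z)) c∉)))

∈interval : ∀ {b c} → interval b c ≡ true → c ℕ.< b
∈interval {suc b} {zero}  _  = s≤s z≤n
∈interval {suc b} {suc c} c∈ = s≤s (∈interval c∈)

count-false : ∀ n → count n (λ _ → false) ≡ 0
count-false zero    = refl
count-false (suc n) = count-false n

count-interval : ∀ {n b} → b ℕ.≤ n → count n (interval b ∘ toℕ) ≡ b
count-interval {n}     {zero}  _         = count-false n
count-interval {suc n} {suc b} (s≤s b≤n) = cong suc (count-interval b≤n)

count-insert : ∀ {n z c} P → z ℕ.< n → P z ≡ false → count n (P ∘ toℕ) ≡ c →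
               count n (insert z P ∘ toℕ) ≡ suc c
count-insert {suc n} {zero}  P _ Pz≡false refl rewrite Pz≡false = refl
count-insert {suc n} {suc z} P (s≤s z<n) Pz≡false refl with P 0
... | true  = cong suc (count-insert (P ∘ suc) z<n Pz≡false refl)
... | false = count-insert (P ∘ suc) z<n Pz≡false refl

count-remove : ∀ {n z c} P → z ℕ.< n → P z ≡ true → count n (P ∘ toℕ) ≡ suc c →
               count n (remove z P ∘ toℕ) ≡ c
count-remove P z<n Pz≡true count≡ = ℕ.suc-injective (trans (removed P z<n Pz≡true) count≡)
  where
  removed : ∀ {n z} P → z ℕ.< n → P z ≡ true → suc (count n (remove z P ∘ toℕ)) ≡ count n (P ∘ toℕ)
  removed {suc n} {zero}  P _ Pz≡true rewrite Pz≡true = refl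
  removed {suc n} {suc z} P (s≤s z<n) Pz≡true with P 0
  ... | true  = cong suc (removed (P ∘ suc) z<n Pz≡true)
  ... | false = removed (P ∘ suc) z<n Pz≡true

C2 : ℕ → ℕ
C2 zero    = 0
C2 (suc m) = m ℕ.+ C2 m

C≡C2 : ∀ m → m C 2 ≡ C2 m
C≡C2 zero    = refl
C≡C2 (suc m) = trans (sym (nCk+nC[k+1]≡[n+1]C[k+1] m 1)) (cong₂ ℕ._+_ (nC1≡n m) (C≡C2 m))

Σpairs≡C2 : ∀ n (f : Fin n → Bool) →
  ΣFin n (λ i → ΣFin n (λ j → 𝟙 ((toℕ i <ᵇ toℕ j) ∧ f i ∧ f j))) ≡ ℕtoℚ (C2 (count n f))
Σpairs≡C2 zero    f = refl
Σpairs≡C2 (suc n) f with f zero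
... | true  = begin
  (0ℚ + ΣFin n (𝟙 ∘ f ∘ suc)) + ΣFin n (λ i → 0ℚ + ΣFin n (λ j → 𝟙 ((toℕ i <ᵇ toℕ j) ∧ f (suc i) ∧ f (suc j))))
    ≡⟨ cong₂ _+_ (trans (+-identityˡ _) (Σ𝟙≡count n (f ∘ suc)))
                 (trans (ΣFin-cong n (λ i → +-identityˡ _)) (Σpairs≡C2 n (f ∘ suc))) ⟩
  ℕtoℚ (count n (f ∘ suc)) + ℕtoℚ (C2 (count n (f ∘ suc)))
    ≡⟨ sym (ℕtoℚ-+ (count n (f ∘ suc)) _) ⟩
  ℕtoℚ (C2 (suc (count n (f ∘ suc)))) ∎
... | false = begin
  (0ℚ + ΣFin n (λ _ → 0ℚ)) + ΣFin n (λ i → 0ℚ + ΣFin n (λ j → 𝟙 ((toℕ i <ᵇ toℕ j) ∧ f (suc i) ∧ f (suc j))))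
    ≡⟨ cong₂ _+_ (trans (+-identityˡ _) (ΣFin-0 n (λ _ → refl)))
                 (trans (ΣFin-cong n (λ i → +-identityˡ _)) (Σpairs≡C2 n (f ∘ suc))) ⟩
  0ℚ + ℕtoℚ (C2 (count n (f ∘ suc)))
    ≡⟨ +-identityˡ _ ⟩
  ℕtoℚ (C2 (count n (f ∘ suc))) ∎

C2-+ : ∀ a b → C2 (a ℕ.+ b) ≡ C2 a ℕ.+ a ℕ.* b ℕ.+ C2 b
C2-+ zero    b = refl
C2-+ (suc a) b rewrite C2-+ a b = rearrange a b (C2 a) (C2 b)
  where
  rearrange : ∀ x y u w → x ℕ.+ y ℕ.+ (u ℕ.+ x ℕ.* y ℕ.+ w) ≡ x ℕ.+ u ℕ.+ (y ℕ.+ x ℕ.* y) ℕ.+ w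
  rearrange = solve-∀

C2≤square : ∀ d → C2 d ℕ.≤ d ℕ.* d
C2≤square zero    = z≤n
C2≤square (suc d) = ℕ.+-mono-≤ (ℕ.n≤1+n d) (ℕ.≤-trans (C2≤square d) (ℕ.*-monoʳ-≤ d (ℕ.n≤1+n d)))

≤-of-+≡ : ∀ a b x y → a ℕ.+ x ≡ b ℕ.+ y → x ℕ.≤ y → b ℕ.≤ a
≤-of-+≡ a b x y eq x≤y = ℕ.+-cancelʳ-≤ x b a (subst (b ℕ.+ x ℕ.≤_) (sym eq) (ℕ.+-monoʳ-≤ b x≤y))

-- Writing c = k + t, the right-hand side exceeds the left by t(t + 1)/2, which vanishes only for t ∈ {0, -1};
-- both bounds are split by the sign of t to avoid subtraction.
pairs-bound : ∀ k d c z → c ℕ.+ z ≡ k ℕ.+ d → k ℕ.* d ℕ.+ C2 d ℕ.≤ d ℕ.* c ℕ.+ C2 z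
pairs-bound k d c z c+z≡k+d with ℕ.≤-total k c
... | inj₁ k≤c with ℕ.m≤n⇒∃[o]m+o≡n k≤c
...   | m , refl with ℕ.+-cancelˡ-≡ k (m ℕ.+ z) d (trans (sym (ℕ.+-assoc k m z)) c+z≡k+d)
...     | refl = ≤-of-+≡ _ _ (C2 m) (m ℕ.* m) identity (C2≤square m)
  where
  identity : (m ℕ.+ z) ℕ.* (k ℕ.+ m) ℕ.+ C2 z ℕ.+ C2 m ≡ k ℕ.* (m ℕ.+ z) ℕ.+ C2 (m ℕ.+ z) ℕ.+ m ℕ.* m
  identity rewrite C2-+ m z = rearrange k m z (C2 m) (C2 z)
    where
    rearrange : ∀ k m z a b →
                (m ℕ.+ z) ℕ.* (k ℕ.+ m) ℕ.+ b ℕ.+ a ≡ k ℕ.* (m ℕ.+ z) ℕ.+ (a ℕ.+ m ℕ.* z ℕ.+ b) ℕ.+ m ℕ.* m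
    rearrange = solve-∀
pairs-bound k d c z c+z≡k+d | inj₂ c≤k with ℕ.m≤n⇒∃[o]m+o≡n c≤k
...   | m , refl with ℕ.+-cancelˡ-≡ c z (m ℕ.+ d) (trans c+z≡k+d (ℕ.+-assoc c m d))
...     | refl = ≤-of-+≡ _ _ 0 (C2 m) identity z≤n
  where
  identity : d ℕ.* c ℕ.+ C2 (m ℕ.+ d) ℕ.+ 0 ≡ (c ℕ.+ m) ℕ.* d ℕ.+ C2 d ℕ.+ C2 m
  identity rewrite C2-+ m d = rearrange c m d (C2 m) (C2 d)
    where
    rearrange : ∀ c m d a b → d ℕ.* c ℕ.+ (a ℕ.+ m ℕ.* d ℕ.+ b) ℕ.+ 0 ≡ (c ℕ.+ m) ℕ.* d ℕ.+ b ℕ.+ a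
    rearrange = solve-∀

pairs-tight : ∀ k d c z → c ℕ.+ z ≡ k ℕ.+ d → z ≡ d ⊎ z ≡ suc d → d ℕ.* c ℕ.+ C2 z ≡ k ℕ.* d ℕ.+ C2 d
pairs-tight k d c z c+z≡k+d (inj₁ refl) with ℕ.+-cancelʳ-≡ d c k c+z≡k+d
... | refl = cong (ℕ._+ C2 d) (ℕ.*-comm d c)
pairs-tight k d c z c+z≡k+d (inj₂ refl) with ℕ.+-cancelʳ-≡ d (suc c) k (trans (sym (ℕ.+-suc c d)) c+z≡k+d)
... | refl = rearrange c d (C2 d)
  where
  rearrange : ∀ c d b → d ℕ.* c ℕ.+ (d ℕ.+ b) ≡ suc c ℕ.* d ℕ.+ b
  rearrange = solve-∀

rhs≡ : ∀ n k → rhs n k ≡ ℕtoℚ (k ℕ.* (n ∸ k) ℕ.+ C2 (n ∸ k))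
rhs≡ n k = cong (λ w → ℕtoℚ (k ℕ.* (n ∸ k) ℕ.+ w)) (C≡C2 (n ∸ k))

split-value : ∀ n k c z → ℕtoℚ ((n ∸ k) ℕ.* c ℕ.+ C2 z) ≡ ℕtoℚ (n ∸ k) * ℕtoℚ c + ℕtoℚ (C2 z)
split-value n k c z = trans (ℕtoℚ-+ ((n ∸ k) ℕ.* c) (C2 z)) (cong (_+ ℕtoℚ (C2 z)) (ℕtoℚ-* (n ∸ k) c))

rhs≤split-value : ∀ {n k} c z → k ℕ.≤ n → c ℕ.+ z ≡ n → rhs n k ≤ ℕtoℚ (n ∸ k) * ℕtoℚ c + ℕtoℚ (C2 z)
rhs≤split-value {n} {k} c z k≤n c+z≡n =
  subst₂ _≤_ (sym (rhs≡ n k)) (split-value n k c z)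
         (ℕtoℚ-mono (pairs-bound k (n ∸ k) c z (trans c+z≡n (sym (ℕ.m+[n∸m]≡n k≤n)))))

rhs≡split-value : ∀ {n k} c z → k ℕ.≤ n → c ℕ.+ z ≡ n → z ≡ n ∸ k ⊎ z ≡ suc (n ∸ k) →
                  ℕtoℚ (n ∸ k) * ℕtoℚ c + ℕtoℚ (C2 z) ≡ rhs n k
rhs≡split-value {n} {k} c z k≤n c+z≡n z≡ =
  trans (sym (split-value n k c z))
        (trans (cong ℕtoℚ (pairs-tight k (n ∸ k) c z (trans c+z≡n (sym (ℕ.m+[n∸m]≡n k≤n))) z≡))
               (sym (rhs≡ n k)))

pair-cover : ∀ a b x y → x ≡ true ⊎ a ≡ true ⊎ b ≡ true ⊎ y ≡ true → 𝟙 (not a ∧ not b) ≤ 𝟙 x + 𝟙 y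
pair-cover a     b     x y (inj₁ refl)               = ≤-trans (𝟙≤1 _) (≤-+𝟙 1ℚ y)
pair-cover a     b     x y (inj₂ (inj₂ (inj₂ refl))) = ≤-trans (𝟙≤1 _) (subst (1ℚ ≤_) (+-comm 1ℚ (𝟙 x)) (≤-+𝟙 1ℚ x))
pair-cover true  b     x y (inj₂ _)                  = +-mono-≤ (𝟙-nonNeg x) (𝟙-nonNeg y)
pair-cover false true  x y (inj₂ _)                  = +-mono-≤ (𝟙-nonNeg x) (𝟙-nonNeg y)
pair-cover false false x y (inj₂ (inj₁ ()))
pair-cover false false x y (inj₂ (inj₂ (inj₁ ())))

module _ {n : ℕ} where

  L₂term-multicut : ∀ δ → IsMulticut (T n) (Sn n) δ → ∀ i j →
    𝟙 ((toℕ i <ᵇ toℕ j) ∧ not (δ (e i)) ∧ not (δ (e j))) ≤ L₂term (incidence (T n) δ) i j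
  L₂term-multicut δ multicut i j with i <? j
  ... | yes i<j rewrite interval-< i<j =
    pair-cover (δ (e i)) (δ (e j)) (δ (eL i j i<j)) (δ (fL i j i<j)) (multicut⇒cutsPaths δ multicut i j i<j)
  ... | no  i≮j rewrite interval-≥ (ℕ.≮⇒≥ i≮j) = ≤-refl

  -- u marks the inner nodes v_a whose edge e_a is kept; fl chooses f_{a,b} over e_{a,b}
  tightCut : (ℕ → Bool) → (ℕ → ℕ → Bool) → TEdge n → Bool
  tightCut u fl (e a)      = not (u (toℕ a))
  tightCut u fl (eL a b _) = not (fl (toℕ a) (toℕ b)) ∧ (u (toℕ a) ∧ u (toℕ b))
  tightCut u fl (fL a b _) = fl (toℕ a) (toℕ b) ∧ (u (toℕ a) ∧ u (toℕ b))

  tightCut-multicut : ∀ u fl → IsMulticut (T n) (Sn n) (tightCut u fl)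
  tightCut-multicut u fl = cutsPaths⇒multicut (tightCut u fl) cuts
    where
    cuts : CutsPaths (tightCut u fl)
    cuts i j p with u (toℕ i) | u (toℕ j) | fl (toℕ i) (toℕ j)
    ... | false | _     | _     = inj₂ (inj₁ refl)
    ... | true  | false | _     = inj₂ (inj₂ (inj₁ refl))
    ... | true  | true  | false = inj₁ refl
    ... | true  | true  | true  = inj₂ (inj₂ (inj₂ refl))

  L₂term-tightCut : ∀ u fl i j →
    L₂term (incidence (T n) (tightCut u fl)) i j ≡ 𝟙 ((toℕ i <ᵇ toℕ j) ∧ u (toℕ i) ∧ u (toℕ j))
  L₂term-tightCut u fl i j with i <? j
  ... | yes i<j rewrite interval-< i<j with fl (toℕ i) (toℕ j) | u (toℕ i) ∧ u (toℕ j)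
  ...   | false | true  = +-identityʳ 1ℚ
  ...   | false | false = refl
  ...   | true  | true  = +-identityˡ 1ℚ
  ...   | true  | false = refl
  L₂term-tightCut u fl i j | no i≮j rewrite interval-≥ (ℕ.≮⇒≥ i≮j) = refl

  multicut∈MultC□ : ∀ δ → IsMulticut (T n) (Sn n) δ → MultC□ (T n) (Sn n) (incidence (T n) δ)
  multicut∈MultC□ δ multicut =
    1 , (λ _ → incidence (T n) δ) , (λ _ → 1ℚ) , (λ _ → δ , multicut , (λ _ → refl)) , (λ _ → 0≤1) , refl ,
    (λ ε → sym (trans (+-identityʳ _) (*-identityˡ _)))

  multicut∈MultC : ∀ δ → IsMulticut (T n) (Sn n) δ → MultC (T n) (Sn n) (incidence (T n) δ)
  multicut∈MultC δ multicut = _ , multicut∈MultC□ δ multicut , (λ _ → ≤-refl)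

  module _ (k : ℕ) where

    L₂term-cong : ∀ {x y : TEdge n → ℚ} → (∀ ε → x ε ≡ y ε) → ∀ i j → L₂term x i j ≡ L₂term y i j
    L₂term-cong x≡y i j with i <? j
    ... | yes p = cong₂ _+_ (x≡y (eL i j p)) (x≡y (fL i j p))
    ... | no  _ = refl

    lhs-cong : ∀ {x y : TEdge n → ℚ} → (∀ ε → x ε ≡ y ε) → lhs n k x ≡ lhs n k y
    lhs-cong x≡y = cong₂ _+_ (cong (ℕtoℚ (n ∸ k) *_) (ΣFin-cong n (x≡y ∘ e)))
                             (ΣFin-cong n (λ i → ΣFin-cong n (L₂term-cong x≡y i)))

    L₂term-mono : ∀ {x y : TEdge n → ℚ} → (∀ ε → x ε ≤ y ε) → ∀ i j → L₂term x i j ≤ L₂term y i j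
    L₂term-mono x≤y i j with i <? j
    ... | yes p = +-mono-≤ (x≤y (eL i j p)) (x≤y (fL i j p))
    ... | no  _ = ≤-refl

    lhs-mono : ∀ {x y : TEdge n → ℚ} → (∀ ε → x ε ≤ y ε) → lhs n k x ≤ lhs n k y
    lhs-mono x≤y = +-mono-≤ (*-monoˡ-≤-nonNeg (ℕtoℚ (n ∸ k)) {{nonNegative (ℕtoℚ-nonNeg (n ∸ k))}}
                                               (ΣFin-mono n (x≤y ∘ e)))
                            (ΣFin-mono n (λ i → ΣFin-mono n (L₂term-mono x≤y i)))

    module _ (M : ℕ) (μ : Fin M → ℚ) (p : Fin M → TEdge n → ℚ) where

      private
        combination : TEdge n → ℚ
        combination ε = ΣFin M (λ g → μ g * p g ε)

        Σ-combination : ∀ m (f : Fin m → Fin M → ℚ) →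
          ΣFin m (λ i → ΣFin M (λ g → μ g * f i g)) ≡ ΣFin M (λ g → μ g * ΣFin m (λ i → f i g))
        Σ-combination m f = trans (ΣFin-comm m M _) (ΣFin-cong M (λ g → ΣFin-*ˡ m (μ g) (λ i → f i g)))

        L₂term-linear : ∀ i j → L₂term combination i j ≡ ΣFin M (λ g → μ g * L₂term (p g) i j)
        L₂term-linear i j with i <? j
        ... | yes _ = trans (sym (ΣFin-+ M _ _)) (ΣFin-cong M (λ g → sym (*-distribˡ-+ (μ g) _ _)))
        ... | no  _ = sym (ΣFin-0 M (λ g → *-zeroʳ (μ g)))

      lhs-linear : lhs n k combination ≡ ΣFin M (λ g → μ g * lhs n k (p g))
      lhs-linear = begin
        c * ΣFin n (λ i → combination (e i)) + ΣFin n (λ i → ΣFin n (L₂term combination i))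
          ≡⟨ cong₂ (λ a b → c * a + b) (Σ-combination n (λ i g → p g (e i)))
               (trans (ΣFin-cong n (λ i → trans (ΣFin-cong n (L₂term-linear i))
                                                (Σ-combination n (λ j g → L₂term (p g) i j))))
                      (Σ-combination n (λ i g → ΣFin n (L₂term (p g) i)))) ⟩
        c * ΣFin M (λ g → μ g * L₁ g) + ΣFin M (λ g → μ g * L₂ g)
          ≡⟨ cong (_+ ΣFin M (λ g → μ g * L₂ g)) (sym (ΣFin-*ˡ M c _)) ⟩
        ΣFin M (λ g → c * (μ g * L₁ g)) + ΣFin M (λ g → μ g * L₂ g)
          ≡⟨ sym (ΣFin-+ M _ _) ⟩
        ΣFin M (λ g → c * (μ g * L₁ g) + μ g * L₂ g)
          ≡⟨ ΣFin-cong M (λ g → solve 4 (λ c u a b → c :* (u :* a) :+ u :* b := u :* (c :* a :+ b))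
                                          refl c (μ g) (L₁ g) (L₂ g)) ⟩
        ΣFin M (λ g → μ g * lhs n k (p g)) ∎
        where
        c = ℕtoℚ (n ∸ k)
        L₁ L₂ : Fin M → ℚ
        L₁ g = ΣFin n (λ i → p g (e i))
        L₂ g = ΣFin n (λ i → ΣFin n (L₂term (p g) i))

    lhs-tightCut : ∀ u fl → lhs n k (incidence (T n) (tightCut u fl)) ≡
      ℕtoℚ (n ∸ k) * ℕtoℚ (count n (not ∘ u ∘ toℕ)) + ℕtoℚ (C2 (count n (u ∘ toℕ)))
    lhs-tightCut u fl =
      cong₂ (λ a b → ℕtoℚ (n ∸ k) * a + b) (Σ𝟙≡count n (not ∘ u ∘ toℕ))
            (trans (ΣFin-cong n (λ i → ΣFin-cong n (L₂term-tightCut u fl i))) (Σpairs≡C2 n (u ∘ toℕ)))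

    module _ (k≤n : k ℕ.≤ n) where

      rhs≤lhs-multicut : ∀ δ → IsMulticut (T n) (Sn n) δ → rhs n k ≤ lhs n k (incidence (T n) δ)
      rhs≤lhs-multicut δ multicut =
        ≤-trans (rhs≤split-value (count n cut) (count n (not ∘ cut)) k≤n (count-not n cut))
                (+-mono-≤ (≤-reflexive (cong (ℕtoℚ (n ∸ k) *_) (sym (Σ𝟙≡count n cut))))
                          (subst (_≤ ΣFin n (λ i → ΣFin n (L₂term (incidence (T n) δ) i)))
                                 (Σpairs≡C2 n (not ∘ cut))
                                 (ΣFin-mono n (λ i → ΣFin-mono n (L₂term-multicut δ multicut i)))))
        where
        cut : Fin n → Bool
        cut i = δ (e i)

      tightCut-tight : ∀ u fl → count n (u ∘ toℕ) ≡ n ∸ k ⊎ count n (u ∘ toℕ) ≡ suc (n ∸ k) →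
                       lhs n k (incidence (T n) (tightCut u fl)) ≡ rhs n k
      tightCut-tight u fl size =
        trans (lhs-tightCut u fl)
              (rhs≡split-value _ _ k≤n (trans (ℕ.+-comm _ (count n (u ∘ toℕ))) (count-not n (u ∘ toℕ)))
                               size)

      rhs≤lhs-MultC□ : ∀ x → MultC□ (T n) (Sn n) x → rhs n k ≤ lhs n k x
      rhs≤lhs-MultC□ x (M , p , λ′ , p-multicut , λ′≥0 , Σλ′≡1 , x≡Σ) =
        subst₂ _≤_ average (sym (trans (lhs-cong x≡Σ) (lhs-linear M λ′ p)))
               (ΣFin-mono M (λ g → *-monoˡ-≤-nonNeg (λ′ g) {{nonNegative (λ′≥0 g)}} (valid g)))
        where
        average : ΣFin M (λ g → λ′ g * rhs n k) ≡ rhs n k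
        average = trans (ΣFin-cong M (λ g → *-comm (λ′ g) (rhs n k)))
                        (trans (ΣFin-*ˡ M (rhs n k) λ′) (trans (cong (rhs n k *_) Σλ′≡1) (*-identityʳ _)))
        valid : ∀ g → rhs n k ≤ lhs n k (p g)
        valid g with p-multicut g
        ... | δ , multicut , p≡δ = subst (rhs n k ≤_) (sym (lhs-cong p≡δ)) (rhs≤lhs-multicut δ multicut)

      rhs≤lhs-MultC : ∀ x → MultC (T n) (Sn n) x → rhs n k ≤ lhs n k x
      rhs≤lhs-MultC x (y , y∈MultC□ , y≤x) = ≤-trans (rhs≤lhs-MultC□ y y∈MultC□) (lhs-mono y≤x)

-- affine forms reading off which of the nodes v_y, v_z a tight point keeps
module _ {n : ℕ} where

  kept dropped : Fin n → Affine (TEdge n)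
  kept    z = const 1ℚ ⊕ coord (- 1ℚ) (e z)
  dropped z = coord 1ℚ (e z)

  bothKept flipped droppedKept bothDropped : ∀ y z → y < z → Affine (TEdge n)
  bothKept    y z p = coord 1ℚ (eL y z p) ⊕ coord 1ℚ (fL y z p)
  flipped     y z p = coord 1ℚ (fL y z p)
  droppedKept y z p = kept z ⊕ coord (- 1ℚ) (eL y z p) ⊕ coord (- 1ℚ) (fL y z p)
  bothDropped y z p = dropped y ⊕ dropped z ⊕ const (- 1ℚ) ⊕ bothKept y z p

  module _ (u : ℕ → Bool) (fl : ℕ → ℕ → Bool) where
    private
      x : TEdge n → ℚ
      x = incidence (T n) (tightCut u fl)

    ⟦kept⟧ : ∀ z → ⟦ kept z ⟧ x ≡ 𝟙 (u (toℕ z))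
    ⟦kept⟧ z with u (toℕ z)
    ... | true  = refl
    ... | false = refl

    ⟦dropped⟧ : ∀ z → ⟦ dropped z ⟧ x ≡ 𝟙 (not (u (toℕ z)))
    ⟦dropped⟧ z with u (toℕ z)
    ... | true  = refl
    ... | false = refl

    ⟦bothKept⟧ : ∀ y z p → ⟦ bothKept y z p ⟧ x ≡ 𝟙 (u (toℕ y) ∧ u (toℕ z))
    ⟦bothKept⟧ y z p with u (toℕ y) | u (toℕ z) | fl (toℕ y) (toℕ z)
    ... | true  | true  | true  = refl
    ... | true  | true  | false = refl
    ... | true  | false | true  = refl
    ... | true  | false | false = refl
    ... | false | true  | true  = refl
    ... | false | true  | false = refl
    ... | false | false | true  = refl
    ... | false | false | false = refl

    ⟦flipped⟧ : ∀ y z p → ⟦ flipped y z p ⟧ x ≡ 𝟙 (fl (toℕ y) (toℕ z) ∧ (u (toℕ y) ∧ u (toℕ z)))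
    ⟦flipped⟧ y z p = *-identityˡ _

    ⟦droppedKept⟧ : ∀ y z p → ⟦ droppedKept y z p ⟧ x ≡ 𝟙 (not (u (toℕ y)) ∧ u (toℕ z))
    ⟦droppedKept⟧ y z p with u (toℕ y) | u (toℕ z) | fl (toℕ y) (toℕ z)
    ... | true  | true  | true  = refl
    ... | true  | true  | false = refl
    ... | true  | false | true  = refl
    ... | true  | false | false = refl
    ... | false | true  | true  = refl
    ... | false | true  | false = refl
    ... | false | false | true  = refl
    ... | false | false | false = refl

    ⟦bothDropped⟧ : ∀ y z p → ⟦ bothDropped y z p ⟧ x ≡ 𝟙 (not (u (toℕ y)) ∧ not (u (toℕ z)))
    ⟦bothDropped⟧ y z p with u (toℕ y) | u (toℕ z) | fl (toℕ y) (toℕ z)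
    ... | true  | true  | true  = refl
    ... | true  | true  | false = refl
    ... | true  | false | true  = refl
    ... | true  | false | false = refl
    ... | false | true  | true  = refl
    ... | false | true  | false = refl
    ... | false | false | true  = refl
    ... | false | false | false = refl

module FacePoints (n k : ℕ) (2≤k : 2 ℕ.≤ k) (k<n : k ℕ.< n) where

  d : ℕ
  d = n ∸ k ∸ 1

  n∸k≡1+d : n ∸ k ≡ suc d
  n∸k≡1+d = sym (ℕ.m+[n∸m]≡n (ℕ.m<n⇒0<n∸m k<n))

  3+d≤n : 3 ℕ.+ d ℕ.≤ n
  3+d≤n = subst (3 ℕ.+ d ℕ.≤_) (trans (cong (k ℕ.+_) (sym n∸k≡1+d)) (ℕ.m+[n∸m]≡n (ℕ.<⇒≤ k<n)))
                (ℕ.+-monoˡ-≤ (suc d) 2≤k)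

  d≤n : d ℕ.≤ n
  d≤n = ℕ.≤-trans (ℕ.m≤n+m d 3) 3+d≤n

  1+d≤n : suc d ℕ.≤ n
  1+d≤n = ℕ.≤-trans (ℕ.m≤n+m (suc d) 2) 3+d≤n

  2+d≤n : 2 ℕ.+ d ℕ.≤ n
  2+d≤n = ℕ.≤-trans (ℕ.m≤n+m (2 ℕ.+ d) 1) 3+d≤n

  -- The kept sets of the face points, of size d + 1 = n - k or d + 2. Nodes z ≥ d + 3 are peeled off one at a time:
  -- a set containing such a z consists of z, at most one more node y and part of [0, d + 1), so the forms testing z
  -- vanish on all points at lower levels. Below d + 3 every subset of [0, d + 3) of size d + 1 or d + 2 occurs.
  flipSet lowPairSet highPairSet basePairSet : ℕ → ℕ → ℕ → Bool
  flipSet     y z = insert (z ⊔ suc d) (insert (y ⊔ d) (interval d))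
  lowPairSet  y z = insert z (remove y (interval (suc d)))
  highPairSet y z = insert z (insert y (interval d))
  basePairSet y z = remove z (remove y (interval (3 ℕ.+ d)))

  highOneSet baseOneSet : ℕ → ℕ → Bool
  highOneSet z = insert z (interval d)
  baseOneSet z = remove z (interval (3 ℕ.+ d))

  data Kind : TEdge n → Set where
    flipPair : ∀ y z p → Kind (fL y z p)
    lowPair  : ∀ y z p → toℕ y ℕ.< d → 3 ℕ.+ d ℕ.≤ toℕ z → Kind (eL y z p)
    highPair : ∀ y z p → d ℕ.≤ toℕ y → 3 ℕ.+ d ℕ.≤ toℕ z → Kind (eL y z p)
    highOne  : ∀ z → 3 ℕ.+ d ℕ.≤ toℕ z → Kind (e z)
    basePair : ∀ y z p → toℕ z ℕ.< 3 ℕ.+ d → Kind (eL y z p)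
    baseOne  : ∀ z → toℕ z ℕ.< 3 ℕ.+ d → Kind (e z)

  kind : ∀ ε → Kind ε
  kind (fL y z p) = flipPair y z p
  kind (e z) with 3 ℕ.+ d ℕ.≤? toℕ z
  ... | yes z≥ = highOne z z≥
  ... | no  z≱ = baseOne z (ℕ.≰⇒> z≱)
  kind (eL y z p) with 3 ℕ.+ d ℕ.≤? toℕ z | toℕ y ℕ.<? d
  ... | yes z≥ | yes y<d = lowPair y z p y<d z≥
  ... | yes z≥ | no  y≮d = highPair y z p (ℕ.≮⇒≥ y≮d) z≥
  ... | no  z≱ | _       = basePair y z p (ℕ.≰⇒> z≱)

  rank : ∀ {ε} → Kind ε → ℕ
  rank (flipPair _ _ _)     = 0
  rank (lowPair _ _ _ _ _)  = 1
  rank (highPair _ _ _ _ _) = 2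
  rank (highOne _ _)        = 3
  rank (basePair _ _ _ _)   = 4
  rank (baseOne _ _)        = 5

  keeps : ∀ {ε} → Kind ε → ℕ → Bool
  keeps (flipPair y z _)     = flipSet (toℕ y) (toℕ z)
  keeps (lowPair y z _ _ _)  = lowPairSet (toℕ y) (toℕ z)
  keeps (highPair y z _ _ _) = highPairSet (toℕ y) (toℕ z)
  keeps (highOne z _)        = highOneSet (toℕ z)
  keeps (basePair y z _ _)   = basePairSet (toℕ y) (toℕ z)
  keeps (baseOne z _)        = baseOneSet (toℕ z)

  flips : ∀ {ε} → Kind ε → ℕ → ℕ → Bool
  flips (flipPair y z _) a b = (a ≡ᵇ toℕ y) ∧ (b ≡ᵇ toℕ z)
  flips _                _ _ = false

  separator : ∀ {ε} → Kind ε → Affine (TEdge n)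
  separator (flipPair y z p)     = flipped y z p
  separator (lowPair y z p _ _)  = droppedKept y z p
  separator (highPair y z p _ _) = bothKept y z p
  separator (highOne z _)        = kept z
  separator (basePair y z p _)   = bothDropped y z p
  separator (baseOne z _)        = dropped z

  passes : ∀ {ε} → Kind ε → (ℕ → Bool) → (ℕ → ℕ → Bool) → Bool
  passes (flipPair y z _)     u fl = fl (toℕ y) (toℕ z) ∧ (u (toℕ y) ∧ u (toℕ z))
  passes (lowPair y z _ _ _)  u fl = not (u (toℕ y)) ∧ u (toℕ z)
  passes (highPair y z _ _ _) u fl = u (toℕ y) ∧ u (toℕ z)
  passes (highOne z _)        u fl = u (toℕ z)
  passes (basePair y z _ _)   u fl = not (u (toℕ y)) ∧ not (u (toℕ z))
  passes (baseOne z _)        u fl = not (u (toℕ z))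

  ⟦separator⟧ : ∀ {ε} (κ : Kind ε) u fl →
                ⟦ separator κ ⟧ (incidence (T n) (tightCut u fl)) ≡ 𝟙 (passes κ u fl)
  ⟦separator⟧ (flipPair y z p)     u fl = ⟦flipped⟧ u fl y z p
  ⟦separator⟧ (lowPair y z p _ _)  u fl = ⟦droppedKept⟧ u fl y z p
  ⟦separator⟧ (highPair y z p _ _) u fl = ⟦bothKept⟧ u fl y z p
  ⟦separator⟧ (highOne z _)        u fl = ⟦kept⟧ u fl z
  ⟦separator⟧ (basePair y z p _)   u fl = ⟦bothDropped⟧ u fl y z p
  ⟦separator⟧ (baseOne z _)        u fl = ⟦dropped⟧ u fl z

  low<high : ∀ {a b} → a ℕ.< d → 3 ℕ.+ d ℕ.≤ b → a ℕ.< b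
  low<high a<d b≥ = ℕ.<-≤-trans a<d (ℕ.≤-trans (ℕ.m≤n+m d 3) b≥)

  d≤high : ∀ {b} → 3 ℕ.+ d ℕ.≤ b → d ℕ.≤ b
  d≤high b≥ = ℕ.≤-trans (ℕ.m≤n+m d 3) b≥

  flipSet-∋ : ∀ {y z} → y ℕ.< z → flipSet y z y ≡ true × flipSet y z z ≡ true
  flipSet-∋ {y} {z} y<z = keepsY , keepsZ
    where
    inner : ∀ c → insert (y ⊔ d) (interval d) c ≡ true → flipSet y z c ≡ true
    inner = insert-⊇ (z ⊔ suc d) (insert (y ⊔ d) (interval d))
    keepsY : flipSet y z y ≡ true
    keepsY with y ℕ.<? d
    ... | yes y<d = inner y (insert-⊇ (y ⊔ d) (interval d) y (interval-< y<d))
    ... | no  y≮d = inner y (subst (λ w → insert w (interval d) y ≡ true)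
                                   (sym (ℕ.m≥n⇒m⊔n≡m (ℕ.≮⇒≥ y≮d))) (insert-self y (interval d)))
    keepsZ : flipSet y z z ≡ true
    keepsZ with ℕ.<-cmp z d
    ... | tri< z<d _ _ = inner z (insert-⊇ (y ⊔ d) (interval d) z (interval-< z<d))
    ... | tri≈ _ z≡d _ = inner z (subst (λ w → insert w (interval d) z ≡ true)
                                        (trans z≡d (sym (ℕ.m≤n⇒m⊔n≡n (ℕ.<⇒≤ (subst (y ℕ.<_) z≡d y<z)))))
                                        (insert-self z (interval d)))
    ... | tri> _ _ d<z = subst (λ w → insert w (insert (y ⊔ d) (interval d)) z ≡ true)
                               (sym (ℕ.m≥n⇒m⊔n≡m d<z)) (insert-self z (insert (y ⊔ d) (interval d)))

  lowPairSet-∋ : ∀ y z {c} → c ℕ.< d → c ≢ y → c ≢ z → lowPairSet y z c ≡ true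
  lowPairSet-∋ y z c<d c≢y c≢z =
    trans (insert-other z (remove y (interval (suc d))) c≢z)
          (trans (remove-other y (interval (suc d)) c≢y) (interval-< (ℕ.m<n⇒m<1+n c<d)))

  lowPairSet-∈ : ∀ y z c → 3 ℕ.+ d ℕ.≤ c → lowPairSet y z c ≡ true → c ≡ z
  lowPairSet-∈ y z c c≥ c∈ with ∈insert z (remove y (interval (suc d))) c c∈
  ... | inj₁ c≡z = c≡z
  ... | inj₂ c∈′ = ⊥-elim (ℕ.<⇒≱ (∈interval {suc d} {c} (∧-conicalʳ (not (c ≡ᵇ y)) _ c∈′))
                                 (ℕ.≤-trans (ℕ.n≤1+n (suc d)) (ℕ.≤-trans (ℕ.n≤1+n (2 ℕ.+ d)) c≥)))

  highPairSet-∋ : ∀ y z {c} → c ℕ.< d → highPairSet y z c ≡ true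
  highPairSet-∋ y z {c} c<d = insert-⊇ z (insert y (interval d)) c (insert-⊇ y (interval d) c (interval-< c<d))

  highPairSet-∈ : ∀ y z c → d ℕ.≤ c → highPairSet y z c ≡ true → c ≡ y ⊎ c ≡ z
  highPairSet-∈ y z c c≥d c∈ with ∈insert z (insert y (interval d)) c c∈
  ... | inj₁ c≡z = inj₂ c≡z
  ... | inj₂ c∈′ with ∈insert y (interval d) c c∈′
  ...   | inj₁ c≡y  = inj₁ c≡y
  ...   | inj₂ c∈″ = ⊥-elim (ℕ.<⇒≱ (∈interval {d} {c} c∈″) c≥d)

  highOneSet-∋ : ∀ z {c} → c ℕ.< d → highOneSet z c ≡ true
  highOneSet-∋ z {c} c<d = insert-⊇ z (interval d) c (interval-< c<d)

  highOneSet-∈ : ∀ z c → d ℕ.≤ c → highOneSet z c ≡ true → c ≡ z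
  highOneSet-∈ z c c≥d c∈ with ∈insert z (interval d) c c∈
  ... | inj₁ c≡z = c≡z
  ... | inj₂ c∈′ = ⊥-elim (ℕ.<⇒≱ (∈interval {d} {c} c∈′) c≥d)

  basePairSet-∌ : ∀ y z {c} → 3 ℕ.+ d ℕ.≤ c → basePairSet y z c ≡ false
  basePairSet-∌ y z {c} c≥ =
    remove-⊆ z (remove y (interval (3 ℕ.+ d))) c (remove-⊆ y (interval (3 ℕ.+ d)) c (interval-≥ c≥))

  basePairSet-∉ : ∀ y z c → c ℕ.< 3 ℕ.+ d → basePairSet y z c ≡ false → c ≡ y ⊎ c ≡ z
  basePairSet-∉ y z c c< c∉ with c ℕ.≟ z
  ... | yes c≡z = inj₂ c≡z
  ... | no  c≢z = inj₁ (∉remove y (interval (3 ℕ.+ d)) c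
                                 (trans (sym (remove-other z (remove y (interval (3 ℕ.+ d))) c≢z)) c∉)
                                 (interval-< c<))

  baseOneSet-∋ : ∀ z {c} → c ℕ.< 3 ℕ.+ d → c ≢ z → baseOneSet z c ≡ true
  baseOneSet-∋ z c< c≢z = trans (remove-other z (interval (3 ℕ.+ d)) c≢z) (interval-< c<)

  baseOneSet-∌ : ∀ z {c} → 3 ℕ.+ d ℕ.≤ c → baseOneSet z c ≡ false
  baseOneSet-∌ z {c} c≥ = remove-⊆ z (interval (3 ℕ.+ d)) c (interval-≥ c≥)

  baseOneSet-∉ : ∀ z c → c ℕ.< 3 ℕ.+ d → baseOneSet z c ≡ false → c ≡ z
  baseOneSet-∉ z c c< c∉ = ∉remove z (interval (3 ℕ.+ d)) c c∉ (interval-< c<)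

  passes-self : ∀ {ε} (κ : Kind ε) → passes κ (keeps κ) (flips κ) ≡ true
  passes-self (flipPair y z p) rewrite ≡ᵇ-refl (toℕ y) | ≡ᵇ-refl (toℕ z) =
    cong₂ _∧_ (proj₁ (flipSet-∋ p)) (proj₂ (flipSet-∋ p))
  passes-self (lowPair y z p _ _) =
    cong₂ (λ a b → not a ∧ b)
          (trans (insert-other (toℕ z) (remove (toℕ y) (interval (suc d))) (ℕ.<⇒≢ p))
                 (remove-self (toℕ y) (interval (suc d))))
          (insert-self (toℕ z) (remove (toℕ y) (interval (suc d))))
  passes-self (highPair y z p _ _) =
    cong₂ _∧_ (insert-⊇ (toℕ z) (insert (toℕ y) (interval d)) (toℕ y) (insert-self (toℕ y) (interval d)))
              (insert-self (toℕ z) (insert (toℕ y) (interval d)))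
  passes-self (highOne z _) = insert-self (toℕ z) (interval d)
  passes-self (basePair y z p _) =
    cong₂ (λ a b → not a ∧ not b)
          (remove-⊆ (toℕ z) (remove (toℕ y) (interval (3 ℕ.+ d))) (toℕ y) (remove-self (toℕ y) (interval (3 ℕ.+ d))))
          (remove-self (toℕ z) (remove (toℕ y) (interval (3 ℕ.+ d))))
  passes-self (baseOne z _) = cong not (remove-self (toℕ z) (interval (3 ℕ.+ d)))

  flipPair-fails : ∀ y z p {ε′} (κ′ : Kind ε′) → fL y z p ≢ ε′ →
                   passes (flipPair y z p) (keeps κ′) (flips κ′) ≡ false
  flipPair-fails y z _ (flipPair y′ z′ p′) ε≢ε′
    rewrite ≡ᵇ-pair {toℕ y} {toℕ y′} {toℕ z} {toℕ z′} (fL-≢ ε≢ε′) = refl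
  flipPair-fails _ _ _ (lowPair _ _ _ _ _)  _ = refl
  flipPair-fails _ _ _ (highPair _ _ _ _ _) _ = refl
  flipPair-fails _ _ _ (highOne _ _)        _ = refl
  flipPair-fails _ _ _ (basePair _ _ _ _)   _ = refl
  flipPair-fails _ _ _ (baseOne _ _)        _ = refl

  lowPair-fails : ∀ y z p y<d z≥ {ε′} (κ′ : Kind ε′) → eL y z p ≢ ε′ → 1 ℕ.≤ rank κ′ →
                  passes (lowPair y z p y<d z≥) (keeps κ′) (flips κ′) ≡ false
  lowPair-fails _ _ _ _ _ (flipPair _ _ _) _ ()
  lowPair-fails y z _ y<d z≥ (lowPair y′ z′ _ _ z′≥) ε≢ε′ _ = ¬-not λ passed →
    let z≡z′ = lowPairSet-∈ (toℕ y′) (toℕ z′) (toℕ z) z≥ (∧-conicalʳ _ _ passed)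
        y≢y′ = λ y≡y′ → eL-≢ ε≢ε′ (y≡y′ , z≡z′)
    in true≢false (trans (sym (lowPairSet-∋ (toℕ y′) (toℕ z′) y<d y≢y′ (ℕ.<⇒≢ (low<high y<d z′≥))))
                         (not-injective (∧-conicalˡ _ _ passed)))
  lowPair-fails _ z _ y<d _ (highPair y′ z′ _ _ _) _ _ =
    cong (λ b → not b ∧ highPairSet (toℕ y′) (toℕ z′) (toℕ z)) (highPairSet-∋ (toℕ y′) (toℕ z′) y<d)
  lowPair-fails _ z _ y<d _ (highOne z′ _) _ _ =
    cong (λ b → not b ∧ highOneSet (toℕ z′) (toℕ z)) (highOneSet-∋ (toℕ z′) y<d)
  lowPair-fails y _ _ _ z≥ (basePair y′ z′ _ _) _ _ =
    trans (cong (not (basePairSet (toℕ y′) (toℕ z′) (toℕ y)) ∧_) (basePairSet-∌ (toℕ y′) (toℕ z′) z≥)) (∧-zeroʳ _)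
  lowPair-fails y _ _ _ z≥ (baseOne z′ _) _ _ =
    trans (cong (not (baseOneSet (toℕ z′) (toℕ y)) ∧_) (baseOneSet-∌ (toℕ z′) z≥)) (∧-zeroʳ _)

  highPair-fails : ∀ y z p d≤y z≥ {ε′} (κ′ : Kind ε′) → eL y z p ≢ ε′ → 2 ℕ.≤ rank κ′ →
                   passes (highPair y z p d≤y z≥) (keeps κ′) (flips κ′) ≡ false
  highPair-fails _ _ _ _ _ (flipPair _ _ _)    _ ()
  highPair-fails _ _ _ _ _ (lowPair _ _ _ _ _) _ (s≤s ())
  highPair-fails y z p d≤y z≥ (highPair y′ z′ p′ _ _) ε≢ε′ _ = ¬-not λ passed →
    eL-≢ ε≢ε′ (same-pair p p′ (highPairSet-∈ (toℕ y′) (toℕ z′) (toℕ y) d≤y (∧-conicalˡ _ _ passed))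
                              (highPairSet-∈ (toℕ y′) (toℕ z′) (toℕ z) (d≤high z≥) (∧-conicalʳ _ _ passed)))
  highPair-fails y z p d≤y z≥ (highOne z′ _) _ _ = ¬-not λ passed →
    ℕ.<-irrefl (trans (highOneSet-∈ (toℕ z′) (toℕ y) d≤y (∧-conicalˡ _ _ passed))
                      (sym (highOneSet-∈ (toℕ z′) (toℕ z) (d≤high z≥) (∧-conicalʳ _ _ passed)))) p
  highPair-fails y _ _ _ z≥ (basePair y′ z′ _ _) _ _ =
    trans (cong (basePairSet (toℕ y′) (toℕ z′) (toℕ y) ∧_) (basePairSet-∌ (toℕ y′) (toℕ z′) z≥)) (∧-zeroʳ _)
  highPair-fails y _ _ _ z≥ (baseOne z′ _) _ _ =
    trans (cong (baseOneSet (toℕ z′) (toℕ y) ∧_) (baseOneSet-∌ (toℕ z′) z≥)) (∧-zeroʳ _)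

  highOne-fails : ∀ z z≥ {ε′} (κ′ : Kind ε′) → e z ≢ ε′ → 3 ℕ.≤ rank κ′ →
                  passes (highOne z z≥) (keeps κ′) (flips κ′) ≡ false
  highOne-fails _ _ (flipPair _ _ _)     _ ()
  highOne-fails _ _ (lowPair _ _ _ _ _)  _ (s≤s ())
  highOne-fails _ _ (highPair _ _ _ _ _) _ (s≤s (s≤s ()))
  highOne-fails z z≥ (highOne z′ _) ε≢ε′ _ =
    ¬-not λ passed → e-≢ ε≢ε′ (highOneSet-∈ (toℕ z′) (toℕ z) (d≤high z≥) passed)
  highOne-fails _ z≥ (basePair y′ z′ _ _) _ _ = basePairSet-∌ (toℕ y′) (toℕ z′) z≥
  highOne-fails _ z≥ (baseOne z′ _)       _ _ = baseOneSet-∌ (toℕ z′) z≥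

  basePair-fails : ∀ y z p z< {ε′} (κ′ : Kind ε′) → eL y z p ≢ ε′ → 4 ℕ.≤ rank κ′ →
                   passes (basePair y z p z<) (keeps κ′) (flips κ′) ≡ false
  basePair-fails _ _ _ _ (flipPair _ _ _)     _ ()
  basePair-fails _ _ _ _ (lowPair _ _ _ _ _)  _ (s≤s ())
  basePair-fails _ _ _ _ (highPair _ _ _ _ _) _ (s≤s (s≤s ()))
  basePair-fails _ _ _ _ (highOne _ _)        _ (s≤s (s≤s (s≤s ())))
  basePair-fails y z p z< (basePair y′ z′ p′ _) ε≢ε′ _ = ¬-not λ passed →
    eL-≢ ε≢ε′ (same-pair p p′ (basePairSet-∉ (toℕ y′) (toℕ z′) (toℕ y) (ℕ.<-trans p z<)
                                             (not-injective (∧-conicalˡ _ _ passed)))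
                              (basePairSet-∉ (toℕ y′) (toℕ z′) (toℕ z) z< (not-injective (∧-conicalʳ _ _ passed))))
  basePair-fails y z p z< (baseOne z′ _) _ _ = ¬-not λ passed →
    ℕ.<-irrefl (trans (baseOneSet-∉ (toℕ z′) (toℕ y) (ℕ.<-trans p z<) (not-injective (∧-conicalˡ _ _ passed)))
                      (sym (baseOneSet-∉ (toℕ z′) (toℕ z) z< (not-injective (∧-conicalʳ _ _ passed))))) p

  baseOne-fails : ∀ z z< {ε′} (κ′ : Kind ε′) → e z ≢ ε′ → 5 ℕ.≤ rank κ′ →
                  passes (baseOne z z<) (keeps κ′) (flips κ′) ≡ false
  baseOne-fails _ _ (flipPair _ _ _)     _ ()
  baseOne-fails _ _ (lowPair _ _ _ _ _)  _ (s≤s ())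
  baseOne-fails _ _ (highPair _ _ _ _ _) _ (s≤s (s≤s ()))
  baseOne-fails _ _ (highOne _ _)        _ (s≤s (s≤s (s≤s ())))
  baseOne-fails _ _ (basePair _ _ _ _)   _ (s≤s (s≤s (s≤s (s≤s ()))))
  baseOne-fails _ z< (baseOne z′ _) ε≢ε′ _ = cong not (baseOneSet-∋ (toℕ z′) z< (e-≢ ε≢ε′))

  fails-higher : ∀ {ε ε′} (κ : Kind ε) (κ′ : Kind ε′) → ε ≢ ε′ → rank κ ℕ.≤ rank κ′ →
                 passes κ (keeps κ′) (flips κ′) ≡ false
  fails-higher (flipPair y z p)         κ′ ε≢ε′ _     = flipPair-fails y z p κ′ ε≢ε′
  fails-higher (lowPair y z p y<d z≥)  κ′ ε≢ε′ rank≤ = lowPair-fails y z p y<d z≥ κ′ ε≢ε′ rank≤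
  fails-higher (highPair y z p d≤y z≥) κ′ ε≢ε′ rank≤ = highPair-fails y z p d≤y z≥ κ′ ε≢ε′ rank≤
  fails-higher (highOne z z≥)          κ′ ε≢ε′ rank≤ = highOne-fails z z≥ κ′ ε≢ε′ rank≤
  fails-higher (basePair y z p z<)     κ′ ε≢ε′ rank≤ = basePair-fails y z p z< κ′ ε≢ε′ rank≤
  fails-higher (baseOne z z<)          κ′ ε≢ε′ rank≤ = baseOne-fails z z< κ′ ε≢ε′ rank≤

  keeps-size : ∀ {ε} (κ : Kind ε) → count n (keeps κ ∘ toℕ) ≡ suc d ⊎ count n (keeps κ ∘ toℕ) ≡ suc (suc d)
  keeps-size (flipPair y z p) = inj₂
    (count-insert (insert (Y ⊔ d) (interval d)) (ℕ.⊔-lub (Fin.toℕ<n z) 2+d≤n)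
                  (trans (insert-other (Y ⊔ d) (interval d) (ℕ.>⇒≢ (ℕ.⊔-mono-< p (ℕ.n<1+n d))))
                         (interval-≥ (ℕ.≤-trans (ℕ.n≤1+n d) (ℕ.m≤n⊔m (toℕ z) (suc d)))))
      (count-insert (interval d) (ℕ.⊔-lub (Fin.toℕ<n y) 1+d≤n) (interval-≥ (ℕ.m≤n⊔m Y d))
        (count-interval d≤n)))
    where Y = toℕ y
  keeps-size (lowPair y z p y<d z≥) = inj₁
    (count-insert (remove (toℕ y) (interval (suc d))) (Fin.toℕ<n z)
                  (remove-⊆ (toℕ y) (interval (suc d)) (toℕ z) (interval-≥ (ℕ.≤-trans (ℕ.m≤n+m (suc d) 2) z≥)))
      (count-remove (interval (suc d)) (Fin.toℕ<n y) (interval-< (ℕ.m<n⇒m<1+n y<d))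
        (count-interval 1+d≤n)))
  keeps-size (highPair y z p d≤y z≥) = inj₂
    (count-insert (insert (toℕ y) (interval d)) (Fin.toℕ<n z)
                  (trans (insert-other (toℕ y) (interval d) (ℕ.>⇒≢ p)) (interval-≥ (d≤high z≥)))
      (count-insert (interval d) (Fin.toℕ<n y) (interval-≥ d≤y) (count-interval d≤n)))
  keeps-size (highOne z z≥) =
    inj₁ (count-insert (interval d) (Fin.toℕ<n z) (interval-≥ (d≤high z≥)) (count-interval d≤n))
  keeps-size (basePair y z p z<) = inj₁
    (count-remove (remove (toℕ y) (interval (3 ℕ.+ d))) (Fin.toℕ<n z)
                  (trans (remove-other (toℕ y) (interval (3 ℕ.+ d)) (ℕ.>⇒≢ p)) (interval-< z<))
      (count-remove (interval (3 ℕ.+ d)) (Fin.toℕ<n y) (interval-< (ℕ.<-trans p z<)) (count-interval 3+d≤n)))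
  keeps-size (baseOne z z<) =
    inj₂ (count-remove (interval (3 ℕ.+ d)) (Fin.toℕ<n z) (interval-< z<) (count-interval 3+d≤n))

  facePoint : TEdge n → TEdge n → ℚ
  facePoint ε = incidence (T n) (tightCut (keeps (kind ε)) (flips (kind ε)))

  facePoint-multicut : ∀ ε → IsMulticut (T n) (Sn n) (tightCut (keeps (kind ε)) (flips (kind ε)))
  facePoint-multicut ε = tightCut-multicut (keeps (kind ε)) (flips (kind ε))

  facePoint-tight : ∀ ε → lhs n k (facePoint ε) ≡ rhs n k
  facePoint-tight ε = tightCut-tight k (ℕ.<⇒≤ k<n) (keeps (kind ε)) (flips (kind ε)) size′
    where
    size′ : count n (keeps (kind ε) ∘ toℕ) ≡ n ∸ k ⊎ count n (keeps (kind ε) ∘ toℕ) ≡ suc (n ∸ k)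
    size′ rewrite n∸k≡1+d = keeps-size (kind ε)

  facePoints-affIndep : AffIndep (facePoint ∘ edge)
  facePoints-affIndep = affIndep-triangular (facePoint ∘ edge) (rank ∘ kind ∘ edge) (separator ∘ kind ∘ edge)
    (λ g → trans (⟦separator⟧ (kind (edge g)) _ _) (cong 𝟙 (passes-self (kind (edge g)))))
    (λ g h g≢h rank≤ → trans (⟦separator⟧ (kind (edge g)) _ _)
                             (cong 𝟙 (fails-higher (kind (edge g)) (kind (edge h)) (edge-injective g≢h) rank≤)))

module _ {n : ℕ} where

  allBut : Fin (n ℕ.* n) → TEdge n → Bool
  allBut g ε = not (index ε == g)

  allBut-multicut : ∀ g → IsMulticut (T n) (Sn n) (allBut g)
  allBut-multicut g = cutsPaths⇒multicut (allBut g) cuts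
    where
    cuts : CutsPaths (allBut g)
    cuts i j p with index (e i) Fin.≟ g
    ... | no  _    = inj₂ (inj₁ refl)
    ... | yes ei≡g = inj₁ (cong not (==-≢ λ eL≡g → e≢eL (index-injective (trans ei≡g (sym eL≡g)))))
      where
      e≢eL : e i ≢ eL i j p
      e≢eL ()

  fullPoint : Fin (suc (n ℕ.* n)) → TEdge n → ℚ
  fullPoint zero    = incidence (T n) (λ _ → true)
  fullPoint (suc g) = incidence (T n) (allBut g)

  fullPoint-multicut : ∀ i → ∃ λ δ → IsMulticut (T n) (Sn n) δ × fullPoint i ≡ incidence (T n) δ
  fullPoint-multicut zero    = (λ _ → true) , cutsPaths⇒multicut (λ _ → true) (λ _ _ _ → inj₁ refl) , refl
  fullPoint-multicut (suc g) = _ , allBut-multicut g , refl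

  fullPoints-affIndep : AffIndep fullPoint
  fullPoints-affIndep = affIndep-triangular fullPoint rank φ own separate
    where
    rank : Fin (suc (n ℕ.* n)) → ℕ
    rank zero    = 1
    rank (suc _) = 0
    φ : Fin (suc (n ℕ.* n)) → Affine (TEdge n)
    φ zero    = const 1ℚ
    φ (suc g) = const 1ℚ ⊕ coord (- 1ℚ) (edge g)
    own : ∀ i → ⟦ φ i ⟧ (fullPoint i) ≡ 1ℚ
    own zero = refl
    own (suc g) =
      cong (λ b → 1ℚ + - 1ℚ * 𝟙 (not b)) (trans (cong (_== g) (index-edge {n} g)) (==-refl {n ℕ.* n} g))
    separate : ∀ i j → i ≢ j → rank i ℕ.≤ rank j → ⟦ φ i ⟧ (fullPoint j) ≡ 0ℚ
    separate zero    (suc _) _   ()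
    separate (suc g) zero    _   _ = refl
    separate (suc g) (suc h) g≢h _ =
      cong (λ b → 1ℚ + - 1ℚ * 𝟙 (not b))
           (trans (cong (_== h) (index-edge {n} g)) (==-≢ {a = g} {b = h} (g≢h ∘ cong suc)))
    separate zero    zero    0≢0 _ = ⊥-elim (0≢0 refl)

module _ {n′ : ℕ} (k : ℕ) where

  private
    n = suc n′

  lhs-supported-at-e₀ : ∀ (x : TEdge n → ℚ) → (∀ ε → ε ≢ e zero → x ε ≡ 0ℚ) →
                        lhs n k x ≡ ℕtoℚ (n ∸ k) * x (e zero)
  lhs-supported-at-e₀ x vanishes = begin
    lhs n k x   ≡⟨ lhs-cong k x≡x₀ ⟩
    lhs n k x₀  ≡⟨ cong₂ (λ a b → ℕtoℚ (n ∸ k) * a + b)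
                         (trans (cong (x (e zero) +_) (ΣFin-0 n′ (λ _ → refl))) (+-identityʳ _))
                         (ΣFin-0 n (λ i → ΣFin-0 n (L₂term-x₀ i))) ⟩
    ℕtoℚ (n ∸ k) * x (e zero) + 0ℚ ≡⟨ +-identityʳ _ ⟩
    ℕtoℚ (n ∸ k) * x (e zero) ∎
    where
    x₀ : TEdge n → ℚ
    x₀ (e zero) = x (e zero)
    x₀ _        = 0ℚ
    x≡x₀ : ∀ ε → x ε ≡ x₀ ε
    x≡x₀ (e zero)    = refl
    x≡x₀ (e (suc i)) = vanishes (e (suc i)) λ ()
    x≡x₀ (eL i j p)  = vanishes (eL i j p) λ ()
    x≡x₀ (fL i j p)  = vanishes (fL i j p) λ ()
    L₂term-x₀ : ∀ i j → L₂term x₀ i j ≡ 0ℚ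
    L₂term-x₀ i j with i <? j
    ... | yes _ = refl
    ... | no  _ = refl

  ¬affIndep-face : k ℕ.< n → (P : (TEdge n → ℚ) → Set) →
    ¬ (Σ (Fin (suc (n ℕ.* n)) → TEdge n → ℚ) λ p →
         ((i : Fin (suc (n ℕ.* n))) → P (p i) × lhs n k (p i) ≡ rhs n k) × AffIndep p)
  ¬affIndep-face k<n P (p , p-tight , indep) = ¬affIndep-hyperplane edge edge-onto p determined indep
    where
    determined : ∀ μ → ΣFin (suc (n ℕ.* n)) μ ≡ 0ℚ →
                 (∀ g → ΣFin (suc (n ℕ.* n)) (λ i → μ i * p i (edge (suc g))) ≡ 0ℚ) →
                 ΣFin (suc (n ℕ.* n)) (λ i → μ i * p i (edge zero)) ≡ 0ℚ
    determined μ Σμ≡0 others =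
      *-cancelˡ-0 (ℕtoℚ (n ∸ k)) n∸k≢0 (trans (sym (lhs-supported-at-e₀ q off-e₀)) lhs-q≡0)
      where
      M = suc (n ℕ.* n)
      q : TEdge n → ℚ
      q ε = ΣFin M (λ i → μ i * p i ε)
      off-e₀ : ∀ ε → ε ≢ e zero → q ε ≡ 0ℚ
      off-e₀ ε ε≢e₀ with index ε | edge-index ε
      ... | zero  | edge≡ε = ⊥-elim (ε≢e₀ (sym edge≡ε))
      ... | suc g | edge≡ε = subst (λ ε′ → q ε′ ≡ 0ℚ) edge≡ε (others g)
      lhs-q≡0 : lhs n k q ≡ 0ℚ
      lhs-q≡0 = begin
        lhs n k q                          ≡⟨ lhs-linear k M μ p ⟩
        ΣFin M (λ i → μ i * lhs n k (p i)) ≡⟨ ΣFin-cong M (λ i → cong (μ i *_) (proj₂ (p-tight i))) ⟩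
        ΣFin M (λ i → μ i * rhs n k)       ≡⟨ ΣFin-cong M (λ i → *-comm (μ i) (rhs n k)) ⟩
        ΣFin M (λ i → rhs n k * μ i)       ≡⟨ ΣFin-*ˡ M (rhs n k) μ ⟩
        rhs n k * ΣFin M μ                 ≡⟨ cong (rhs n k *_) Σμ≡0 ⟩
        rhs n k * 0ℚ                       ≡⟨ *-zeroʳ (rhs n k) ⟩
        0ℚ                                 ∎
      n∸k≢0 : ℕtoℚ (n ∸ k) ≢ 0ℚ
      n∸k≢0 = subst (λ m → ℕtoℚ m ≢ 0ℚ) (ℕ.m+[n∸m]≡n (ℕ.m<n⇒0<n∸m k<n)) (ℕtoℚ-suc≢0 (n ∸ k ∸ 1))

facetDefining : ∀ n k → 2 ℕ.≤ k → k ℕ.< n → (P : (TEdge n → ℚ) → Set) →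
  (∀ x → P x → rhs n k ≤ lhs n k x) → (∀ δ → IsMulticut (T n) (Sn n) δ → P (incidence (T n) δ)) →
  FacetDefining P (lhs n k) (rhs n k)
facetDefining (suc n′) k 2≤k k<n P valid multicut∈P = valid , n ℕ.* n , full , face
  where
  n = suc n′
  open FacePoints n k 2≤k k<n
  full : AffRank P (suc (n ℕ.* n))
  full = (fullPoint , fullPoint∈P , fullPoints-affIndep)
       , λ (p , _ , indep) → ¬affIndep-full edge edge-onto p indep
    where
    fullPoint∈P : ∀ i → P (fullPoint i)
    fullPoint∈P i with fullPoint-multicut i
    ... | δ , multicut , point≡ = subst P (sym point≡) (multicut∈P δ multicut)
  face : AffRank (λ x → P x × lhs n k x ≡ rhs n k) (n ℕ.* n)
  face = (facePoint ∘ edge , (λ g → multicut∈P _ (facePoint-multicut (edge g)) , facePoint-tight (edge g))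
                           , facePoints-affIndep)
       , ¬affIndep-face k k<n P

theorem6p1 : (n k : ℕ) → 2 ℕ.≤ k → k ℕ.< n →
    SharedFacet (T n) (Sn n) (lhs n k) (rhs n k)
theorem6p1 n k 2≤k k<n =
  facetDefining n k 2≤k k<n (MultC (T n) (Sn n)) (rhs≤lhs-MultC k (ℕ.<⇒≤ k<n)) multicut∈MultC ,
  facetDefining n k 2≤k k<n (MultC□ (T n) (Sn n)) (rhs≤lhs-MultC□ k (ℕ.<⇒≤ k<n)) multicut∈MultC□
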